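{- Let $n,m\ge 1$, let $0=s[0]<s[1]<\dots<s[m]=n$ be integers, let $d_1,\dots,d_n$ be positive integers, let $\bar a_0,\dots,\bar a_m$ be integers, and let $f_i:[0,d_i]\to\mathbb{R}$ ($i=1,\dots,n$) be proper convex functions. For $1\le v\le w\le m$ let $\textsc{Nested}(v,w)$ denote the problem, in the integer variables $x_{s[v-1]+1},\dots,x_{s[w]}$, $$\min \sum_{i=s[v-1]+1}^{s[w]} f_i(x_i)\quad\text{s.t.}\quad \sum_{k=s[v-1]+1}^{s[i]}x_k\le \bar a_i-\bar a_{v-1}\ (i=v,\dots,w-1),\quad \sum_{i=s[v-1]+1}^{s[w]}x_i=\bar a_w-\bar a_{v-1},\quad 0\le x_i\le d_i,\ x_i\in\mathbb{Z}.$$ Let $1\le v\le t\le w\le m$ with $v<w$ (and $t<w$), and let $(x^{\downarrow*}_{s[v-1]+1},\dots,x^{\downarrow*}_{s[t]})$ and $(x^{\uparrow*}_{s[t]+1},\dots,x^{\uparrow*}_{s[w]})$ be optimal solutions of $\textsc{Nested}(v,t)$ and $\textsc{Nested}(t+1,w)$, respectively. Then $\textsc{Nested}(v,w)$ admits an optimal solution $(x^{**}_{s[v-1]+1},\dots,x^{**}_{s[w]})$ such that $x^{**}_i\le x^{\downarrow*}_i$ for all $i\in\{s[v-1]+1,\dots,s[t]\}$ and $x^{**}_i\ge x^{\uparrow*}_i$ for all $i\in\{s[t]+1,\dots,s[w]\}$.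
   Context: In the paper, $\bar a_0=0$, $\bar a_m=B$ and $\bar a_i$ ($1\le i\le m-1$) are tightened bounds of the nested constraints $\sum_{k=1}^{s[i]}x_k\le a_i$ of a nested resource allocation problem; $\textsc{Nested}(v,w)$ is the subproblem on the variables of blocks $v,\dots,w$ assuming the nested constraints $v-1$ and $w$ are tight. -}

module Defs where

open import Level using (0ℓ)
open import Data.Nat as ℕ using (ℕ; zero; suc; _∸_)
open import Data.Integer as ℤ using (ℤ; +_)
open import Relation.Binary.PropositionalEquality using (_≡_)
open import Relation.Binary.Structures using (IsTotalOrder)
open import Algebra.Structures using (IsAbelianGroup)
open import Data.Product using (_×_; Σ)

-- A totally ordered abelian group (e.g. (ℝ, +, ≤)).  The objective values
-- of the paper are reals; we work over an arbitrary ordered abelian group,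
-- which contains ℝ as an instance.
record OrderedAbelianGroup : Set₁ where
  infixl 6 _+_
  infix 4 _≤_
  field
    Carrier        : Set
    _+_            : Carrier → Carrier → Carrier
    0#             : Carrier
    -_             : Carrier → Carrier
    _≤_            : Carrier → Carrier → Set
    isAbelianGroup : IsAbelianGroup _≡_ _+_ 0# -_
    isTotalOrder   : IsTotalOrder _≡_ _≤_
    +-monoˡ-≤      : ∀ {a b} c → a ≤ b → a + c ≤ b + c

sumFrom : (ℕ → ℤ) → ℕ → ℕ → ℤ
sumFrom x a zero    = + 0
sumFrom x a (suc l) = x (a ℕ.+ suc l) ℤ.+ sumFrom x a l

-- Σ_{k = a+1}^{b} x k  (empty if b ≤ a)
sumRange : (ℕ → ℤ) → ℕ → ℕ → ℤ
sumRange x a b = sumFrom x a (b ∸ a)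

module _ (G : OrderedAbelianGroup) where
  open OrderedAbelianGroup G

  sumFromG : (ℕ → Carrier) → ℕ → ℕ → Carrier
  sumFromG g a zero    = 0#
  sumFromG g a (suc l) = g (a ℕ.+ suc l) + sumFromG g a l

  sumRangeG : (ℕ → Carrier) → ℕ → ℕ → Carrier
  sumRangeG g a b = sumFromG g a (b ∸ a)

  -- f i restricted to the integer points of [0, d i] is convex:
  -- f(z+1) - f(z) ≤ f(z+2) - f(z+1) whenever 0 ≤ z and z+2 ≤ d i.
  DiscretelyConvexOn : ℕ → (ℤ → Carrier) → Set
  DiscretelyConvexOn dᵢ g =
    ∀ (z : ℤ) → + 0 ℤ.≤ z → z ℤ.+ + 2 ℤ.≤ + dᵢ →
      g (z ℤ.+ + 1) + g (z ℤ.+ + 1) ≤ g z + g (z ℤ.+ + 2)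

  record Instance : Set where
    field
      n m : ℕ
      s   : ℕ → ℕ
      d   : ℕ → ℕ
      ā   : ℕ → ℤ
      f   : ℕ → ℤ → Carrier

  module _ (I : Instance) where
    open Instance I

    -- Feasibility for NESTED(v,w): only x_{s[v-1]+1}, …, x_{s[w]} matter.
    Feasible : ℕ → ℕ → (ℕ → ℤ) → Set
    Feasible v w x =
      (∀ i → v ℕ.≤ i → i ℕ.< w →
         sumRange x (s (v ∸ 1)) (s i) ℤ.≤ ā i ℤ.- ā (v ∸ 1))
      × (sumRange x (s (v ∸ 1)) (s w) ≡ ā w ℤ.- ā (v ∸ 1))
      × (∀ i → s (v ∸ 1) ℕ.< i → i ℕ.≤ s w → (+ 0 ℤ.≤ x i) × (x i ℤ.≤ + d i))

    cost : ℕ → ℕ → (ℕ → ℤ) → Carrier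
    cost v w x = sumRangeG (λ i → f i (x i)) (s (v ∸ 1)) (s w)

    Optimal : ℕ → ℕ → (ℕ → ℤ) → Set
    Optimal v w x = Feasible v w x × (∀ y → Feasible v w y → cost v w x ≤ cost v w y)

-- Let x↓ and x↑ be optimal for NESTED(v,t) and NESTED(t+1,w).  Gluing them
-- gives a feasible solution of NESTED(v,w); as its feasible set is a finite set
-- of integer points, NESTED(v,w) has an optimal solution y*.  We then push y*
-- below x↓ on the left block and above x↑ on the right block by unit exchanges.
-- If y exceeds x↓ first at i, we find a partner j where y falls short of x↓ such
-- that moving a unit of y from i to j and a unit of x↓ from j to i keeps both
-- feasible (j lies after or before i according to whether y and x↓ have equal
-- sums before i).  By discrete convexity the two moves do not increase the joint
-- cost, so by optimality of x↓ the cost of y does not increase, while its ℓ¹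
-- distance to x↓ drops.  The right block is handled symmetrically with x↑.
module Submission where

open import Level using (0ℓ)
open import Data.Nat as ℕ using (ℕ; zero; suc; _∸_; z≤n; s≤s)
import Data.Nat.Properties as ℕₚ
open import Data.Integer as ℤ using (ℤ; +_)
import Data.Integer.Properties as ℤₚ
open import Data.Integer.Tactic.RingSolver using (solve-∀)
open import Data.Product using (_×_; Σ; _,_; proj₁; proj₂)
open import Data.Sum using (_⊎_; inj₁; inj₂)
open import Data.Empty using (⊥-elim)
open import Relation.Nullary using (¬_; Dec; yes; no; ¬?; _×-dec_; _⊎-dec_)
open import Relation.Nullary.Decidable using (decidable-stable; map′; _→-dec_)
open import Data.List using (List; []; _∷_; map; concatMap; upTo; filter)
import Data.List.Relation.Unary.All as All
open import Data.List.Membership.Propositional using (_∈_)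
open import Data.List.Membership.Propositional.Properties using (∈-concatMap⁺; ∈-map⁺; ∈-upTo⁺; ∈-filter⁺; ∈-filter⁻)
open import Data.List.Relation.Unary.Any as Any using (here)
open import Relation.Binary.PropositionalEquality
open import Algebra.Bundles using (CommutativeMonoid)
open import Algebra.Structures using (IsAbelianGroup)
open import Relation.Binary.Structures using (IsTotalOrder)
open import Relation.Binary.Bundles using (TotalOrder)

open import Defs

_[_≔_] : {A : Set} → (ℕ → A) → ℕ → A → ℕ → A
(g [ i ≔ c ]) k with k ℕ.≟ i
... | yes _ = c
... | no _  = g k

≔-same : ∀ {A : Set} (g : ℕ → A) i c → (g [ i ≔ c ]) i ≡ c
≔-same g i c with i ℕ.≟ i
... | yes _  = refl
... | no i≢i = ⊥-elim (i≢i refl)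

≔-other : ∀ {A : Set} (g : ℕ → A) {i k} c → k ≢ i → (g [ i ≔ c ]) k ≡ g k
≔-other g {i} {k} c k≢i with k ℕ.≟ i
... | yes k≡i = ⊥-elim (k≢i k≡i)
... | no _    = refl

module GroupSums (G : OrderedAbelianGroup) where
  open OrderedAbelianGroup G
  open IsAbelianGroup isAbelianGroup using (isCommutativeMonoid; inverse)
    renaming (assoc to +-assoc; comm to +-comm; identityˡ to +-identityˡ; identityʳ to +-identityʳ)
  open IsTotalOrder isTotalOrder public using ()
    renaming (refl to ≤-refl; trans to ≤-trans; reflexive to ≤-reflexive)

  commutativeMonoid : CommutativeMonoid 0ℓ 0ℓ
  commutativeMonoid = record { isCommutativeMonoid = isCommutativeMonoid }

  open import Algebra.Solver.CommutativeMonoid commutativeMonoid public using (solve; _⊜_; _⊕_)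

  +-monoʳ-≤ : ∀ {a b} c → a ≤ b → c + a ≤ c + b
  +-monoʳ-≤ {a} {b} c a≤b = subst₂ _≤_ (+-comm a c) (+-comm b c) (+-monoˡ-≤ c a≤b)

  +-mono-≤ : ∀ {a b c d} → a ≤ b → c ≤ d → a + c ≤ b + d
  +-mono-≤ {b = b} {c} a≤b c≤d = ≤-trans (+-monoˡ-≤ c a≤b) (+-monoʳ-≤ b c≤d)

  +-cancelʳ-≤ : ∀ {a b} c → a + c ≤ b + c → a ≤ b
  +-cancelʳ-≤ {a} {b} c h = subst₂ _≤_ (undo a) (undo b) (+-monoˡ-≤ (- c) h)
    where
    undo : ∀ x → x + c + - c ≡ x
    undo x = trans (+-assoc x c (- c)) (trans (cong (λ u → x + u) (proj₂ inverse c)) (+-identityʳ x))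

  +-cancelˡ-≤ : ∀ {a b} c → c + a ≤ c + b → a ≤ b
  +-cancelˡ-≤ {a} {b} c h = +-cancelʳ-≤ c (subst₂ _≤_ (+-comm c a) (+-comm c b) h)

  totalOrder : TotalOrder 0ℓ 0ℓ 0ℓ
  totalOrder = record { Carrier = Carrier ; _≈_ = _≡_ ; _≤_ = _≤_ ; isTotalOrder = isTotalOrder }

  Σ[_] : (ℕ → Carrier) → ℕ → ℕ → Carrier
  Σ[_] = sumRangeG G

  private
    S : (ℕ → Carrier) → ℕ → ℕ → Carrier
    S = sumFromG G

    below-top : ∀ a l {k} → k ℕ.≤ a ℕ.+ l → k ℕ.≤ a ℕ.+ suc l
    below-top a l k≤ = ℕₚ.≤-trans k≤ (ℕₚ.+-monoʳ-≤ a (ℕₚ.n≤1+n l))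

    top-in : ∀ a l → a ℕ.< a ℕ.+ suc l
    top-in a l = ℕₚ.m<m+n a (s≤s z≤n)

    S-cong : ∀ g h a l → (∀ k → a ℕ.< k → k ℕ.≤ a ℕ.+ l → g k ≡ h k) → S g a l ≡ S h a l
    S-cong g h a zero    _ = refl
    S-cong g h a (suc l) e =
      cong₂ _+_ (e _ (top-in a l) ℕₚ.≤-refl) (S-cong g h a l (λ k p q → e k p (below-top a l q)))

    S-mono : ∀ g h a l → (∀ k → a ℕ.< k → k ℕ.≤ a ℕ.+ l → g k ≤ h k) → S g a l ≤ S h a l
    S-mono g h a zero    _ = ≤-refl
    S-mono g h a (suc l) e =
      +-mono-≤ (e _ (top-in a l) ℕₚ.≤-refl) (S-mono g h a l (λ k p q → e k p (below-top a l q)))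

    S-split : ∀ g a l₁ l₂ → S g a (l₁ ℕ.+ l₂) ≡ S g (a ℕ.+ l₁) l₂ + S g a l₁
    S-split g a l₁ zero rewrite ℕₚ.+-identityʳ l₁ = sym (+-identityˡ _)
    S-split g a l₁ (suc l₂) rewrite ℕₚ.+-suc l₁ l₂ =
      trans (cong₂ _+_ (cong g (sym (trans (ℕₚ.+-assoc a l₁ (suc l₂)) (cong (a ℕ.+_) (ℕₚ.+-suc l₁ l₂)))))
                       (S-split g a l₁ l₂))
            (sym (+-assoc _ _ _))

    S-update : ∀ g g′ a l i → a ℕ.< i → i ℕ.≤ a ℕ.+ l →
               (∀ k → a ℕ.< k → k ℕ.≤ a ℕ.+ l → k ≢ i → g′ k ≡ g k) →
               S g′ a l + g i ≡ S g a l + g′ i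
    S-update g g′ a zero    i a<i i≤ _ = ⊥-elim (ℕₚ.<⇒≱ a<i (subst (i ℕ.≤_) (ℕₚ.+-identityʳ a) i≤))
    S-update g g′ a (suc l) i a<i i≤ e with a ℕ.+ suc l ℕ.≟ i
    ... | yes refl =
      trans (cong (λ u → g′ (a ℕ.+ suc l) + u + g (a ℕ.+ suc l)) (S-cong g′ g a l outside))
            (solve 3 (λ x y z → (x ⊕ y) ⊕ z ⊜ (z ⊕ y) ⊕ x) refl _ _ _)
      where
      outside : ∀ k → a ℕ.< k → k ℕ.≤ a ℕ.+ l → g′ k ≡ g k
      outside k a<k k≤ = e k a<k (below-top a l k≤)
                           (λ { refl → ℕₚ.<⇒≱ (ℕₚ.+-monoʳ-< a (ℕₚ.n<1+n l)) k≤ })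
    ... | no top≢i =
      trans (cong (λ u → u + S g′ a l + g i) (e _ (top-in a l) ℕₚ.≤-refl top≢i))
            (trans (+-assoc _ _ _)
                   (trans (cong (λ u → g (a ℕ.+ suc l) + u)
                                (S-update g g′ a l i a<i i≤a+l (λ k p q → e k p (below-top a l q))))
                          (sym (+-assoc _ _ _))))
      where
      i≤a+l : i ℕ.≤ a ℕ.+ l
      i≤a+l = ℕₚ.≤-pred (subst (i ℕ.<_) (ℕₚ.+-suc a l) (ℕₚ.≤∧≢⇒< i≤ (λ x → top≢i (sym x))))

    top≡ : ∀ {a b} → a ℕ.≤ b → a ℕ.+ (b ∸ a) ≡ b
    top≡ = ℕₚ.m+[n∸m]≡n

  Σ-cong : ∀ g h a b → (∀ k → a ℕ.< k → k ℕ.≤ b → g k ≡ h k) → Σ[ g ] a b ≡ Σ[ h ] a b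
  Σ-cong g h a b e with a ℕ.≤? b
  ... | yes a≤b = S-cong g h a (b ∸ a) (λ k p q → e k p (subst (k ℕ.≤_) (top≡ a≤b) q))
  ... | no a≰b rewrite ℕₚ.m≤n⇒m∸n≡0 (ℕₚ.≰⇒≥ a≰b) = refl

  Σ-mono : ∀ g h a b → (∀ k → a ℕ.< k → k ℕ.≤ b → g k ≤ h k) → Σ[ g ] a b ≤ Σ[ h ] a b
  Σ-mono g h a b e with a ℕ.≤? b
  ... | yes a≤b = S-mono g h a (b ∸ a) (λ k p q → e k p (subst (k ℕ.≤_) (top≡ a≤b) q))
  ... | no a≰b rewrite ℕₚ.m≤n⇒m∸n≡0 (ℕₚ.≰⇒≥ a≰b) = ≤-refl

  Σ-split : ∀ g {a b c} → a ℕ.≤ b → b ℕ.≤ c → Σ[ g ] a c ≡ Σ[ g ] b c + Σ[ g ] a b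
  Σ-split g {a} {b} {c} a≤b b≤c = begin
    S g a (c ∸ a)                         ≡⟨ cong (S g a) lengths ⟩
    S g a ((b ∸ a) ℕ.+ (c ∸ b))           ≡⟨ S-split g a (b ∸ a) (c ∸ b) ⟩
    S g (a ℕ.+ (b ∸ a)) (c ∸ b) + S g a (b ∸ a)
      ≡⟨ cong (λ u → S g u (c ∸ b) + S g a (b ∸ a)) (top≡ a≤b) ⟩
    S g b (c ∸ b) + S g a (b ∸ a)         ∎
    where
    open ≡-Reasoning
    lengths : c ∸ a ≡ (b ∸ a) ℕ.+ (c ∸ b)
    lengths = begin
      c ∸ a                         ≡⟨ cong (_∸ a) (sym (ℕₚ.m∸n+n≡m b≤c)) ⟩
      (c ∸ b) ℕ.+ b ∸ a             ≡⟨ ℕₚ.+-∸-assoc (c ∸ b) a≤b ⟩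
      (c ∸ b) ℕ.+ (b ∸ a)           ≡⟨ ℕₚ.+-comm (c ∸ b) (b ∸ a) ⟩
      (b ∸ a) ℕ.+ (c ∸ b)           ∎

  Σ-update : ∀ g g′ {a b i} → a ℕ.< i → i ℕ.≤ b →
             (∀ k → a ℕ.< k → k ℕ.≤ b → k ≢ i → g′ k ≡ g k) →
             Σ[ g′ ] a b + g i ≡ Σ[ g ] a b + g′ i
  Σ-update g g′ {a} {b} {i} a<i i≤b e =
    S-update g g′ a (b ∸ a) i a<i (subst (i ℕ.≤_) (sym b≡) i≤b) (λ k p q → e k p (subst (k ℕ.≤_) b≡ q))
    where
    b≡ : a ℕ.+ (b ∸ a) ≡ b
    b≡ = top≡ (ℕₚ.≤-trans (ℕₚ.<⇒≤ a<i) i≤b)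

  Σ-update₂ : ∀ g g′ {a b i j} → i ≢ j → a ℕ.< i → i ℕ.≤ b → a ℕ.< j → j ℕ.≤ b →
              (∀ k → a ℕ.< k → k ℕ.≤ b → k ≢ i → k ≢ j → g′ k ≡ g k) →
              Σ[ g′ ] a b + g i + g j ≡ Σ[ g ] a b + g′ i + g′ j
  Σ-update₂ g g′ {a} {b} {i} {j} i≢j a<i i≤b a<j j≤b e = begin
    Σ[ g′ ] a b + g i + g j   ≡⟨ swap₂ _ _ _ ⟩
    Σ[ g′ ] a b + g j + g i   ≡⟨ cong (λ u → Σ[ g′ ] a b + u + g i) (sym (h-at-j)) ⟩
    Σ[ g′ ] a b + h j + g i   ≡⟨ cong (_+ g i) (Σ-update h g′ a<j j≤b g′≈h) ⟩
    Σ[ h ] a b + g′ j + g i   ≡⟨ swap₂ _ _ _ ⟩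
    Σ[ h ] a b + g i + g′ j   ≡⟨ cong (_+ g′ j) (Σ-update g h a<i i≤b (λ k _ _ → h-off-i k)) ⟩
    Σ[ g ] a b + h i + g′ j   ≡⟨ cong (λ u → Σ[ g ] a b + u + g′ j) h-at-i ⟩
    Σ[ g ] a b + g′ i + g′ j  ∎
    where
    open ≡-Reasoning
    swap₂ : ∀ x y z → x + y + z ≡ x + z + y
    swap₂ = solve 3 (λ x y z → (x ⊕ y) ⊕ z ⊜ (x ⊕ z) ⊕ y) refl
    h : ℕ → Carrier
    h = g [ i ≔ g′ i ]
    h-at-i : h i ≡ g′ i
    h-at-i = ≔-same g i (g′ i)
    h-at-j : h j ≡ g j
    h-at-j = ≔-other g (g′ i) (λ j≡i → i≢j (sym j≡i))
    h-off-i : ∀ k → k ≢ i → h k ≡ g k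
    h-off-i k = ≔-other g (g′ i)
    g′≈h : ∀ k → a ℕ.< k → k ℕ.≤ b → k ≢ j → g′ k ≡ h k
    g′≈h k a<k k≤b k≢j = by-cases (k ℕ.≟ i)
      where
      by-cases : Dec (k ≡ i) → g′ k ≡ h k
      by-cases (yes refl) = sym h-at-i
      by-cases (no k≢i)   = trans (e k a<k k≤b k≢i k≢j) (sym (h-off-i k k≢i))

-- The integers as an ordered abelian group; the integer range sums of Defs
-- (sumRange) coincide with the group range sums, so they inherit the lemmas.
ℤ-group : OrderedAbelianGroup
ℤ-group = record
  { Carrier = ℤ ; _+_ = ℤ._+_ ; 0# = + 0 ; -_ = ℤ.-_ ; _≤_ = ℤ._≤_
  ; isAbelianGroup = ℤₚ.+-0-isAbelianGroup ; isTotalOrder = ℤₚ.≤-isTotalOrder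
  ; +-monoˡ-≤ = λ c → ℤₚ.+-monoˡ-≤ c }

module ℤΣ = GroupSums ℤ-group

sumRange≡Σ : ∀ y a b → sumRange y a b ≡ ℤΣ.Σ[ y ] a b
sumRange≡Σ y a b = go (b ∸ a)
  where
  go : ∀ l → sumFrom y a l ≡ sumFromG ℤ-group y a l
  go zero    = refl
  go (suc l) = cong (λ u → y (a ℕ.+ suc l) ℤ.+ u) (go l)

sum-cong : ∀ y z a b → (∀ k → a ℕ.< k → k ℕ.≤ b → y k ≡ z k) → sumRange y a b ≡ sumRange z a b
sum-cong y z a b e rewrite sumRange≡Σ y a b | sumRange≡Σ z a b = ℤΣ.Σ-cong y z a b e

sum-mono : ∀ y z a b → (∀ k → a ℕ.< k → k ℕ.≤ b → y k ℤ.≤ z k) → sumRange y a b ℤ.≤ sumRange z a b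
sum-mono y z a b e rewrite sumRange≡Σ y a b | sumRange≡Σ z a b = ℤΣ.Σ-mono y z a b e

sum-split : ∀ y {a b c} → a ℕ.≤ b → b ℕ.≤ c → sumRange y a c ≡ sumRange y b c ℤ.+ sumRange y a b
sum-split y {a} {b} {c} a≤b b≤c
  rewrite sumRange≡Σ y a c | sumRange≡Σ y b c | sumRange≡Σ y a b = ℤΣ.Σ-split y a≤b b≤c

sum-empty : ∀ y a → sumRange y a a ≡ + 0
sum-empty y a rewrite ℕₚ.n∸n≡0 a = refl

sum-single : ∀ y a → sumRange y a (suc a) ≡ y (suc a)
sum-single y a rewrite ℕₚ.m+n∸n≡m 1 a | ℕₚ.+-comm a 1 = ℤₚ.+-identityʳ _

sum-last : ∀ y {a b} → a ℕ.≤ b → sumRange y a (suc b) ≡ y (suc b) ℤ.+ sumRange y a b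
sum-last y {a} {b} a≤b =
  trans (sum-split y a≤b (ℕₚ.n≤1+n b)) (cong (ℤ._+ sumRange y a b) (sum-single y b))

sum-shift : ∀ y y′ {a b i} c → a ℕ.< i → i ℕ.≤ b →
            (∀ k → a ℕ.< k → k ℕ.≤ b → k ≢ i → y′ k ≡ y k) → y′ i ≡ y i ℤ.+ c →
            sumRange y′ a b ≡ sumRange y a b ℤ.+ c
sum-shift y y′ {a} {b} {i} c a<i i≤b e y′i = begin
  sumRange y′ a b                            ≡⟨ regroup (sumRange y′ a b) (y i) ⟩
  sumRange y′ a b ℤ.+ y i ℤ.- y i            ≡⟨ cong (ℤ._- y i) updated ⟩
  sumRange y a b ℤ.+ (y i ℤ.+ c) ℤ.- y i     ≡⟨ cancel (sumRange y a b) (y i) c ⟩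
  sumRange y a b ℤ.+ c                       ∎
  where
  open ≡-Reasoning
  regroup : ∀ s u → s ≡ s ℤ.+ u ℤ.- u
  regroup = solve-∀
  cancel : ∀ s u c → s ℤ.+ (u ℤ.+ c) ℤ.- u ≡ s ℤ.+ c
  cancel = solve-∀
  updated : sumRange y′ a b ℤ.+ y i ≡ sumRange y a b ℤ.+ (y i ℤ.+ c)
  updated rewrite sumRange≡Σ y′ a b | sumRange≡Σ y a b | sym y′i = ℤΣ.Σ-update y y′ a<i i≤b e

transfer : (ℕ → ℤ) → ℕ → ℕ → ℕ → ℤ
transfer y i j k with k ℕ.≟ i | k ℕ.≟ j
... | yes _ | _     = y k ℤ.- + 1
... | no _  | yes _ = y k ℤ.+ + 1
... | no _  | no _  = y k

transfer-source : ∀ y i j → transfer y i j i ≡ y i ℤ.- + 1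
transfer-source y i j with i ℕ.≟ i
... | yes _   = refl
... | no i≢i  = ⊥-elim (i≢i refl)

transfer-target : ∀ y {i j} → i ≢ j → transfer y i j j ≡ y j ℤ.+ + 1
transfer-target y {i} {j} i≢j with j ℕ.≟ i | j ℕ.≟ j
... | yes j≡i | _      = ⊥-elim (i≢j (sym j≡i))
... | no _    | yes _  = refl
... | no _    | no j≢j = ⊥-elim (j≢j refl)

transfer-other : ∀ y {i j k} → k ≢ i → k ≢ j → transfer y i j k ≡ y k
transfer-other y {i} {j} {k} k≢i k≢j with k ℕ.≟ i | k ℕ.≟ j
... | yes k≡i | _       = ⊥-elim (k≢i k≡i)
... | no _    | yes k≡j = ⊥-elim (k≢j k≡j)
... | no _    | no _    = refl

module _ (y : ℕ → ℤ) {i j a : ℕ} (i≢j : i ≢ j) (a<i : a ℕ.< i) (a<j : a ℕ.< j) where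

  private
    y′ : ℕ → ℤ
    y′ = transfer y i j

    only-source : ∀ {b} → i ℕ.≤ b → ¬ (j ℕ.≤ b) → sumRange y′ a b ≡ sumRange y a b ℤ.- + 1
    only-source {b} i≤b j≰b = sum-shift y y′ (ℤ.- + 1) a<i i≤b
      (λ k _ k≤b k≢i → transfer-other y k≢i (λ { refl → j≰b k≤b })) (transfer-source y i j)

    only-target : ∀ {b} → ¬ (i ℕ.≤ b) → j ℕ.≤ b → sumRange y′ a b ≡ sumRange y a b ℤ.+ + 1
    only-target {b} i≰b j≤b = sum-shift y y′ (+ 1) a<j j≤b
      (λ k _ k≤b k≢j → transfer-other y (λ { refl → i≰b k≤b }) k≢j) (transfer-target y i≢j)

    neither : ∀ {b} → ¬ (i ℕ.≤ b) → ¬ (j ℕ.≤ b) → sumRange y′ a b ≡ sumRange y a b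
    neither {b} i≰b j≰b = sum-cong y′ y a b
      (λ k _ k≤b → transfer-other y (λ { refl → i≰b k≤b }) (λ { refl → j≰b k≤b }))

  transfer-sum-both : ∀ {b} → i ℕ.≤ b → j ℕ.≤ b → sumRange y′ a b ≡ sumRange y a b
  transfer-sum-both {b} i≤b j≤b = trans (sum-shift z y′ (+ 1) a<j j≤b agree target) first-step
    where
    z : ℕ → ℤ
    z = y [ i ≔ y i ℤ.- + 1 ]
    z-at-i : z i ≡ y i ℤ.+ ℤ.- + 1
    z-at-i = ≔-same y i (y i ℤ.- + 1)
    z-off-i : ∀ k → k ≢ i → z k ≡ y k
    z-off-i k = ≔-other y (y i ℤ.- + 1)
    agree : ∀ k → a ℕ.< k → k ℕ.≤ b → k ≢ j → y′ k ≡ z k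
    agree k _ _ k≢j = by-cases (k ℕ.≟ i)
      where
      by-cases : Dec (k ≡ i) → y′ k ≡ z k
      by-cases (yes refl) = trans (transfer-source y i j) (sym z-at-i)
      by-cases (no k≢i)   = trans (transfer-other y k≢i k≢j) (sym (z-off-i k k≢i))
    target : y′ j ≡ z j ℤ.+ + 1
    target = trans (transfer-target y i≢j) (cong (ℤ._+ + 1) (sym (z-off-i j (λ j≡i → i≢j (sym j≡i)))))
    first-step : sumRange z a b ℤ.+ + 1 ≡ sumRange y a b
    first-step = trans (cong (ℤ._+ + 1) (sum-shift y z (ℤ.- + 1) a<i i≤b (λ k _ _ → z-off-i k) z-at-i))
                       (cancel (sumRange y a b))
      where
      cancel : ∀ s → s ℤ.+ ℤ.- + 1 ℤ.+ + 1 ≡ s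
      cancel = solve-∀

  transfer-sum : ∀ b → sumRange y′ a b ℤ.≤ sumRange y a b
                     ⊎ (j ℕ.≤ b × b ℕ.< i × sumRange y′ a b ≡ sumRange y a b ℤ.+ + 1)
  transfer-sum b with i ℕ.≤? b | j ℕ.≤? b
  ... | yes i≤b | yes j≤b = inj₁ (ℤₚ.≤-reflexive (transfer-sum-both i≤b j≤b))
  ... | yes i≤b | no j≰b  = inj₁ (ℤₚ.≤-trans (ℤₚ.≤-reflexive (only-source i≤b j≰b)) (ℤₚ.i-j≤i _ (+ 1)))
  ... | no i≰b  | yes j≤b = inj₂ (j≤b , ℕₚ.≰⇒> i≰b , only-target i≰b j≤b)
  ... | no i≰b  | no j≰b  = inj₁ (ℤₚ.≤-reflexive (neither i≰b j≰b))

module Convexity (G : OrderedAbelianGroup) where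
  open OrderedAbelianGroup G
  open GroupSums G
  open IsAbelianGroup isAbelianGroup using () renaming (comm to +-comm)

  -- Chaining increment comparisons: a - c ≤ d - b ≤ e - d gives a - c ≤ e - d
  -- (written additively).
  increments-trans : ∀ {a b c d e} → a + b ≤ c + d → d + d ≤ b + e → a + d ≤ c + e
  increments-trans {a} {b} {c} {d} {e} h₁ h₂ =
    +-cancelʳ-≤ (b + d) (subst₂ _≤_ (regroup a b c d e) (regroup′ a b c d e) (+-mono-≤ h₁ h₂))
    where
    regroup : ∀ a b c d e → a + b + (d + d) ≡ a + d + (b + d)
    regroup = solve 5 (λ a b c d e → (a ⊕ b) ⊕ (d ⊕ d) ⊜ (a ⊕ d) ⊕ (b ⊕ d)) refl
    regroup′ : ∀ a b c d e → c + d + (b + e) ≡ c + e + (b + d)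
    regroup′ = solve 5 (λ a b c d e → (c ⊕ d) ⊕ (b ⊕ e) ⊜ (c ⊕ e) ⊕ (b ⊕ d)) refl

  increments-monotone : ∀ {dᵢ g} → DiscretelyConvexOn G dᵢ g → ∀ {z} k → + 0 ℤ.≤ z →
    z ℤ.+ + k ℤ.+ + 1 ℤ.≤ + dᵢ → g (z ℤ.+ + 1) + g (z ℤ.+ + k) ≤ g z + g (z ℤ.+ + k ℤ.+ + 1)
  increments-monotone {g = g} convex {z} zero 0≤z _ rewrite ℤₚ.+-identityʳ z = ≤-reflexive (+-comm _ _)
  increments-monotone {dᵢ} {g} convex {z} (suc k) 0≤z bound =
    subst₂ _≤_ (cong (λ u → g (z ℤ.+ + 1) + g u) (sym next))
               (cong (λ u → g z + g u) (sym next+1))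
               (increments-trans (increments-monotone convex k 0≤z bound′) at-z+k)
    where
    next : z ℤ.+ + suc k ≡ z ℤ.+ + k ℤ.+ + 1
    next = shift z (+ k)
      where shift : ∀ z k → z ℤ.+ (+ 1 ℤ.+ k) ≡ z ℤ.+ k ℤ.+ + 1
            shift = solve-∀
    next+1 : z ℤ.+ + suc k ℤ.+ + 1 ≡ z ℤ.+ + k ℤ.+ + 2
    next+1 = shift z (+ k)
      where shift : ∀ z k → z ℤ.+ (+ 1 ℤ.+ k) ℤ.+ + 1 ≡ z ℤ.+ k ℤ.+ + 2
            shift = solve-∀
    bound′ : z ℤ.+ + k ℤ.+ + 1 ℤ.≤ + dᵢ
    bound′ = ℤₚ.≤-trans (ℤₚ.≤-reflexive (sym next)) (ℤₚ.≤-trans (ℤₚ.i≤i+j _ (+ 1)) bound)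
    at-z+k : g (z ℤ.+ + k ℤ.+ + 1) + g (z ℤ.+ + k ℤ.+ + 1) ≤ g (z ℤ.+ + k) + g (z ℤ.+ + k ℤ.+ + 2)
    at-z+k = convex (z ℤ.+ + k) (ℤₚ.≤-trans 0≤z (ℤₚ.i≤i+j z (+ k)))
                    (subst (ℤ._≤ + dᵢ) next+1 bound)

  towards-each-other : ∀ {dᵢ g} → DiscretelyConvexOn G dᵢ g → ∀ {u w} → + 0 ℤ.≤ u →
    u ℤ.+ + 1 ℤ.≤ w → w ℤ.≤ + dᵢ → g (u ℤ.+ + 1) + g (w ℤ.- + 1) ≤ g u + g w
  towards-each-other {dᵢ} {g} convex {u} {w} 0≤u u<w w≤d =
    subst₂ _≤_ (cong (λ z → g (u ℤ.+ + 1) + g z) (sym w-1≡))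
               (cong (λ z → g u + g z) (sym w≡))
               (increments-monotone convex ∣δ∣ 0≤u (subst (ℤ._≤ + dᵢ) w≡ w≤d))
    where
    δ : ℤ
    δ = w ℤ.- (u ℤ.+ + 1)
    ∣δ∣ : ℕ
    ∣δ∣ = ℤ.∣ δ ∣
    +∣δ∣≡δ : + ∣δ∣ ≡ δ
    +∣δ∣≡δ = ℤₚ.0≤i⇒+∣i∣≡i (ℤₚ.i≤j⇒0≤j-i u<w)
    w-1≡ : w ℤ.- + 1 ≡ u ℤ.+ + ∣δ∣
    w-1≡ = trans (shift u w) (cong (λ z → u ℤ.+ z) (sym +∣δ∣≡δ))
      where shift : ∀ u w → w ℤ.- + 1 ≡ u ℤ.+ (w ℤ.- (u ℤ.+ + 1))
            shift = solve-∀
    w≡ : w ≡ u ℤ.+ + ∣δ∣ ℤ.+ + 1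
    w≡ = trans (shift u w) (cong (λ z → u ℤ.+ z ℤ.+ + 1) (sym +∣δ∣≡δ))
      where shift : ∀ u w → w ≡ u ℤ.+ (w ℤ.- (u ℤ.+ + 1)) ℤ.+ + 1
            shift = solve-∀

  transfer-cost : ∀ (f : ℕ → ℤ → Carrier) y {a b i j} → i ≢ j →
    a ℕ.< i → i ℕ.≤ b → a ℕ.< j → j ℕ.≤ b →
    Σ[ (λ k → f k (transfer y i j k)) ] a b + f i (y i) + f j (y j)
      ≡ Σ[ (λ k → f k (y k)) ] a b + f i (y i ℤ.- + 1) + f j (y j ℤ.+ + 1)
  transfer-cost f y {a} {b} {i} {j} i≢j a<i i≤b a<j j≤b =
    trans (Σ-update₂ (λ k → f k (y k)) (λ k → f k (transfer y i j k)) i≢j a<i i≤b a<j j≤b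
             (λ k _ _ k≢i k≢j → cong (f k) (transfer-other y k≢i k≢j)))
          (cong₂ (λ u v → Σ[ (λ k → f k (y k)) ] a b + u + v) (cong (f i) (transfer-source y i j))
                                      (cong (f j) (transfer-target y i≢j)))

  record Exchange (f : ℕ → ℤ → Carrier) (d : ℕ → ℕ) (y x : ℕ → ℤ) (ay by ax bx i j : ℕ) : Set where
    field
      i≢j : i ≢ j
      ay<i : ay ℕ.< i
      i≤by : i ℕ.≤ by
      ay<j : ay ℕ.< j
      j≤by : j ℕ.≤ by
      ax<i : ax ℕ.< i
      i≤bx : i ℕ.≤ bx
      ax<j : ax ℕ.< j
      j≤bx : j ℕ.≤ bx
      convex-i : DiscretelyConvexOn G (d i) (f i)
      convex-j : DiscretelyConvexOn G (d j) (f j)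
      0≤xi  : + 0 ℤ.≤ x i
      xi<yi : x i ℤ.+ + 1 ℤ.≤ y i
      yi≤d  : y i ℤ.≤ + d i
      0≤yj  : + 0 ℤ.≤ y j
      yj<xj : y j ℤ.+ + 1 ℤ.≤ x j
      xj≤d  : x j ℤ.≤ + d j

  module _ {f : ℕ → ℤ → Carrier} {d : ℕ → ℕ} {y x : ℕ → ℤ} {ay by ax bx i j : ℕ}
           (E : Exchange f d y x ay by ax bx i j) where
    open Exchange E

    private
      Cy Cx Cy′ Cx′ : Carrier
      Cy  = Σ[ (λ k → f k (y k)) ] ay by
      Cx  = Σ[ (λ k → f k (x k)) ] ax bx
      Cy′ = Σ[ (λ k → f k (transfer y i j k)) ] ay by
      Cx′ = Σ[ (λ k → f k (transfer x j i k)) ] ax bx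

    exchange-inequality : Cy′ + Cx′ ≤ Cy + Cx
    exchange-inequality =
      +-cancelʳ-≤ K (subst₂ _≤_ moved unmoved (+-monoʳ-≤ (Cy + Cx) (+-mono-≤ at-i at-j)))
      where
      a a′ c c′ b b′ e e′ K : Carrier
      a  = f i (y i) ; a′ = f i (y i ℤ.- + 1) ; c = f i (x i) ; c′ = f i (x i ℤ.+ + 1)
      b  = f j (y j) ; b′ = f j (y j ℤ.+ + 1) ; e = f j (x j) ; e′ = f j (x j ℤ.- + 1)
      K = a + b + (e + c)
      at-i : c′ + a′ ≤ c + a
      at-i = towards-each-other convex-i 0≤xi xi<yi yi≤d
      at-j : b′ + e′ ≤ b + e
      at-j = towards-each-other convex-j 0≤yj yj<xj xj≤d
      moved : Cy + Cx + (c′ + a′ + (b′ + e′)) ≡ Cy′ + Cx′ + K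
      moved = begin
        Cy + Cx + (c′ + a′ + (b′ + e′))
          ≡⟨ solve 6 (λ Cy Cx a′ b′ c′ e′ → (Cy ⊕ Cx) ⊕ ((c′ ⊕ a′) ⊕ (b′ ⊕ e′))
                                              ⊜ ((Cy ⊕ a′) ⊕ b′) ⊕ ((Cx ⊕ e′) ⊕ c′)) refl Cy Cx a′ b′ c′ e′ ⟩
        (Cy + a′ + b′) + (Cx + e′ + c′)
          ≡⟨ sym (cong₂ _+_ (transfer-cost f y i≢j ay<i i≤by ay<j j≤by)
                            (transfer-cost f x (λ j≡i → i≢j (sym j≡i)) ax<j j≤bx ax<i i≤bx)) ⟩
        (Cy′ + a + b) + (Cx′ + e + c)
          ≡⟨ solve 6 (λ Cy′ Cx′ a b c e → ((Cy′ ⊕ a) ⊕ b) ⊕ ((Cx′ ⊕ e) ⊕ c)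
                                            ⊜ (Cy′ ⊕ Cx′) ⊕ ((a ⊕ b) ⊕ (e ⊕ c))) refl Cy′ Cx′ a b c e ⟩
        Cy′ + Cx′ + K ∎
        where open ≡-Reasoning
      unmoved : Cy + Cx + (c + a + (b + e)) ≡ Cy + Cx + K
      unmoved = cong (λ u → Cy + Cx + u)
                     (solve 4 (λ a b c e → (c ⊕ a) ⊕ (b ⊕ e) ⊜ (a ⊕ b) ⊕ (e ⊕ c)) refl a b c e)

    exchange-improves : Cx ≤ Cx′ → Cy′ ≤ Cy
    exchange-improves x-unimproved =
      +-cancelʳ-≤ Cx (≤-trans (+-monoʳ-≤ Cy′ x-unimproved) exchange-inequality)

private
  up-to-top : ∀ {P : ℕ → Set} {b k} → P (suc b) → (k ℕ.≤ b → P k) → k ℕ.≤ suc b → P k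
  up-to-top P-top below k≤ with ℕₚ.m≤n⇒m<n∨m≡n k≤
  ... | inj₁ k<  = below (ℕₚ.≤-pred k<)
  ... | inj₂ refl = P-top

LeastFailure : (ℕ → Set) → ℕ → ℕ → Set
LeastFailure P a b = (∀ k → a ℕ.< k → k ℕ.≤ b → P k) ⊎
                     Σ ℕ (λ i → a ℕ.< i × i ℕ.≤ b × ¬ P i × (∀ k → a ℕ.< k → k ℕ.< i → P k))

GreatestFailure : (ℕ → Set) → ℕ → ℕ → Set
GreatestFailure P a b = (∀ k → a ℕ.< k → k ℕ.≤ b → P k) ⊎
                        Σ ℕ (λ i → a ℕ.< i × i ℕ.≤ b × ¬ P i × (∀ k → i ℕ.< k → k ℕ.≤ b → P k))

least-failure : (P : ℕ → Set) → (∀ k → Dec (P k)) → ∀ a b → LeastFailure P a b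
least-failure P P? a zero = inj₁ (λ k a<k k≤0 → ⊥-elim (ℕₚ.<⇒≱ a<k (ℕₚ.≤-trans k≤0 z≤n)))
least-failure P P? a (suc b) with least-failure P P? a b
... | inj₂ (i , a<i , i≤b , ¬Pi , below) = inj₂ (i , a<i , ℕₚ.m≤n⇒m≤1+n i≤b , ¬Pi , below)
... | inj₁ upto-b with a ℕ.<? suc b | P? (suc b)
...   | no a≮  | _      = inj₁ (λ k a<k k≤ → ⊥-elim (a≮ (ℕₚ.<-≤-trans a<k k≤)))
...   | yes a< | no ¬P  = inj₂ (suc b , a< , ℕₚ.≤-refl , ¬P , λ k a<k k< → upto-b k a<k (ℕₚ.≤-pred k<))
...   | yes _  | yes P-top = inj₁ (λ k a<k → up-to-top {P} P-top (upto-b k a<k))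

greatest-failure : (P : ℕ → Set) → (∀ k → Dec (P k)) → ∀ a b → GreatestFailure P a b
greatest-failure P P? a zero = inj₁ (λ k a<k k≤0 → ⊥-elim (ℕₚ.<⇒≱ a<k (ℕₚ.≤-trans k≤0 z≤n)))
greatest-failure P P? a (suc b) with a ℕ.<? suc b | P? (suc b)
... | no a≮  | _     = inj₁ (λ k a<k k≤ → ⊥-elim (a≮ (ℕₚ.<-≤-trans a<k k≤)))
... | yes a< | no ¬P = inj₂ (suc b , a< , ℕₚ.≤-refl , ¬P , λ k b<k k≤b → ⊥-elim (ℕₚ.<⇒≱ b<k k≤b))
... | yes _  | yes P-top with greatest-failure P P? a b
...   | inj₁ upto-b = inj₁ (λ k a<k → up-to-top {P} P-top (upto-b k a<k))
...   | inj₂ (i , a<i , i≤b , ¬Pi , above) =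
  inj₂ (i , a<i , ℕₚ.m≤n⇒m≤1+n i≤b , ¬Pi , λ k i<k → up-to-top {P} P-top (above k i<k))

closer-from-above : ∀ {u v} → v ℤ.+ + 1 ℤ.≤ u → ℤ.∣ u ℤ.- + 1 ℤ.- v ∣ ℕ.< ℤ.∣ u ℤ.- v ∣
closer-from-above {u} {v} v<u = subst₂ (λ a b → ℤ.∣ a ∣ ℕ.< ℤ.∣ b ∣) (sym gap-1) (sym gap) ℕₚ.≤-refl
  where
  δ : ℤ
  δ = u ℤ.- (v ℤ.+ + 1)
  +∣δ∣≡δ : + ℤ.∣ δ ∣ ≡ δ
  +∣δ∣≡δ = ℤₚ.0≤i⇒+∣i∣≡i (ℤₚ.i≤j⇒0≤j-i v<u)
  gap-1 : u ℤ.- + 1 ℤ.- v ≡ + ℤ.∣ δ ∣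
  gap-1 = trans (shift u v) (sym +∣δ∣≡δ)
    where shift : ∀ u v → u ℤ.- + 1 ℤ.- v ≡ u ℤ.- (v ℤ.+ + 1)
          shift = solve-∀
  gap : u ℤ.- v ≡ + 1 ℤ.+ + ℤ.∣ δ ∣
  gap = trans (shift u v) (cong (λ z → + 1 ℤ.+ z) (sym +∣δ∣≡δ))
    where shift : ∀ u v → u ℤ.- v ≡ + 1 ℤ.+ (u ℤ.- (v ℤ.+ + 1))
          shift = solve-∀

closer-from-below : ∀ {u v} → u ℤ.+ + 1 ℤ.≤ v → ℤ.∣ u ℤ.+ + 1 ℤ.- v ∣ ℕ.< ℤ.∣ u ℤ.- v ∣
closer-from-below {u} {v} u<v =
  subst₂ ℕ._<_ (trans (cong ℤ.∣_∣ (mirror u v)) (ℤₚ.∣i-j∣≡∣j-i∣ v (u ℤ.+ + 1)))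
               (ℤₚ.∣i-j∣≡∣j-i∣ v u)
               (closer-from-above u<v)
  where
  mirror : ∀ u v → v ℤ.- + 1 ℤ.- u ≡ v ℤ.- (u ℤ.+ + 1)
  mirror = solve-∀

sumFromℕ : (ℕ → ℕ) → ℕ → ℕ → ℕ
sumFromℕ g a zero    = 0
sumFromℕ g a (suc l) = g (a ℕ.+ suc l) ℕ.+ sumFromℕ g a l

private
  below-top : ∀ a l {k} → k ℕ.≤ a ℕ.+ l → k ℕ.≤ a ℕ.+ suc l
  below-top a l k≤ = ℕₚ.≤-trans k≤ (ℕₚ.+-monoʳ-≤ a (ℕₚ.n≤1+n l))

sumFromℕ-mono : ∀ g h a l → (∀ k → a ℕ.< k → k ℕ.≤ a ℕ.+ l → g k ℕ.≤ h k) →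
                sumFromℕ g a l ℕ.≤ sumFromℕ h a l
sumFromℕ-mono g h a zero    _ = z≤n
sumFromℕ-mono g h a (suc l) e =
  ℕₚ.+-mono-≤ (e _ (ℕₚ.m<m+n a (s≤s z≤n)) ℕₚ.≤-refl)
              (sumFromℕ-mono g h a l (λ k p q → e k p (below-top a l q)))

sumFromℕ-strict : ∀ g h a l {i} → a ℕ.< i → i ℕ.≤ a ℕ.+ l → g i ℕ.< h i →
  (∀ k → a ℕ.< k → k ℕ.≤ a ℕ.+ l → g k ℕ.≤ h k) → sumFromℕ g a l ℕ.< sumFromℕ h a l
sumFromℕ-strict g h a zero {i} a<i i≤ _ _ =
  ⊥-elim (ℕₚ.<⇒≱ a<i (subst (i ℕ.≤_) (ℕₚ.+-identityʳ a) i≤))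
sumFromℕ-strict g h a (suc l) {i} a<i i≤ gi<hi e with a ℕ.+ suc l ℕ.≟ i
... | yes refl = ℕₚ.+-mono-<-≤ gi<hi (sumFromℕ-mono g h a l (λ k p q → e k p (below-top a l q)))
... | no top≢i = ℕₚ.+-mono-≤-< (e _ (ℕₚ.m<m+n a (s≤s z≤n)) ℕₚ.≤-refl)
                   (sumFromℕ-strict g h a l a<i i≤a+l gi<hi (λ k p q → e k p (below-top a l q)))
  where
  i≤a+l : i ℕ.≤ a ℕ.+ l
  i≤a+l = ℕₚ.≤-pred (subst (i ℕ.<_) (ℕₚ.+-suc a l) (ℕₚ.≤∧≢⇒< i≤ (λ x → top≢i (sym x))))

distance : (ℕ → ℤ) → (ℕ → ℤ) → ℕ → ℕ → ℕ
distance x y a b = sumFromℕ (λ k → ℤ.∣ y k ℤ.- x k ∣) a (b ∸ a)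

transfer-closer : ∀ x y {a b i j} → i ≢ j → a ℕ.< i → i ℕ.≤ b → a ℕ.< j → j ℕ.≤ b →
  x i ℤ.+ + 1 ℤ.≤ y i → y j ℤ.+ + 1 ℤ.≤ x j → distance x (transfer y i j) a b ℕ.< distance x y a b
transfer-closer x y {a} {b} {i} {j} i≢j a<i i≤b a<j j≤b xi<yi yj<xj =
  sumFromℕ-strict (λ k → ℤ.∣ transfer y i j k ℤ.- x k ∣) (λ k → ℤ.∣ y k ℤ.- x k ∣) a (b ∸ a)
    a<i (subst (i ℕ.≤_) (sym b≡) i≤b) at-i (λ k _ _ → pointwise k)
  where
  b≡ : a ℕ.+ (b ∸ a) ≡ b
  b≡ = ℕₚ.m+[n∸m]≡n (ℕₚ.≤-trans (ℕₚ.<⇒≤ a<i) i≤b)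
  at-i : ℤ.∣ transfer y i j i ℤ.- x i ∣ ℕ.< ℤ.∣ y i ℤ.- x i ∣
  at-i rewrite transfer-source y i j = closer-from-above xi<yi
  pointwise : ∀ k → ℤ.∣ transfer y i j k ℤ.- x k ∣ ℕ.≤ ℤ.∣ y k ℤ.- x k ∣
  pointwise k = by-cases (k ℕ.≟ i) (k ℕ.≟ j)
    where
    by-cases : Dec (k ≡ i) → Dec (k ≡ j) → ℤ.∣ transfer y i j k ℤ.- x k ∣ ℕ.≤ ℤ.∣ y k ℤ.- x k ∣
    by-cases (yes refl) _ = ℕₚ.<⇒≤ at-i
    by-cases (no k≢i) (yes refl) rewrite transfer-target y i≢j = ℕₚ.<⇒≤ (closer-from-below {y k} yj<xj)
    by-cases (no k≢i) (no k≢j) rewrite transfer-other y k≢i k≢j = ℕₚ.≤-refl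

+1≤-from-≰ : ∀ {a b} → ¬ (a ℤ.≤ b) → b ℤ.+ + 1 ℤ.≤ a
+1≤-from-≰ {a} {b} a≰b = subst (ℤ._≤ a) (ℤₚ.+-comm (+ 1) b) (ℤₚ.i<j⇒suc[i]≤j (ℤₚ.≰⇒> a≰b))

+1≤-from-≢ : ∀ {a b} → a ℤ.≤ b → a ≢ b → a ℤ.+ + 1 ℤ.≤ b
+1≤-from-≢ {a} {b} a≤b a≢b = subst (ℤ._≤ b) (ℤₚ.+-comm (+ 1) a) (ℤₚ.i<j⇒suc[i]≤j (ℤₚ.≤∧≢⇒< a≤b a≢b))

+1≤⇒≱ : ∀ {a b} → a ℤ.+ + 1 ℤ.≤ b → ¬ (b ℤ.≤ a)
+1≤⇒≱ {a} {b} a<b b≤a = ℤₚ.<⇒≱ (ℤₚ.suc[i]≤j⇒i<j (subst (ℤ._≤ b) (ℤₚ.+-comm a (+ 1)) a<b)) b≤a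

settings : (ℕ → ℤ) → ℕ → ℕ → List (ℕ → ℤ)
settings g i dᵢ = map (λ c → g [ i ≔ + c ]) (upTo (suc dᵢ))

boxes : (ℕ → ℕ) → ℕ → ℕ → List (ℕ → ℤ)
boxes d a zero    = (λ _ → + 0) ∷ []
boxes d a (suc l) = concatMap (λ g → settings g (a ℕ.+ suc l) (d (a ℕ.+ suc l))) (boxes d a l)

boxes-complete : (d : ℕ → ℕ) (a l : ℕ) (y : ℕ → ℤ) → (∀ k → a ℕ.< k → k ℕ.≤ a ℕ.+ l → (+ 0 ℤ.≤ y k) × (y k ℤ.≤ + d k)) →
  Σ (ℕ → ℤ) λ g → g ∈ boxes d a l × (∀ k → a ℕ.< k → k ℕ.≤ a ℕ.+ l → g k ≡ y k)
boxes-complete d a zero y _ =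
  (λ _ → + 0) , here refl , λ k a<k k≤ → ⊥-elim (ℕₚ.<⇒≱ a<k (subst (k ℕ.≤_) (ℕₚ.+-identityʳ a) k≤))
boxes-complete d a (suc l) y in-box
  with boxes-complete d a l y (λ k a<k k≤ → in-box k a<k (ℕₚ.≤-trans k≤ (ℕₚ.+-monoʳ-≤ a (ℕₚ.n≤1+n l))))
... | g , g∈ , agree = g [ i ≔ + c ] , member , agree′
  where
  i : ℕ
  i = a ℕ.+ suc l
  c : ℕ
  c = ℤ.∣ y i ∣
  y-at-i : (+ 0 ℤ.≤ y i) × (y i ℤ.≤ + d i)
  y-at-i = in-box i (ℕₚ.m<m+n a (s≤s z≤n)) ℕₚ.≤-refl
  +c≡yi : + c ≡ y i
  +c≡yi = ℤₚ.0≤i⇒+∣i∣≡i (proj₁ y-at-i)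
  c≤d : c ℕ.< suc (d i)
  c≤d = s≤s (ℤₚ.drop‿+≤+ (subst (ℤ._≤ + d i) (sym +c≡yi) (proj₂ y-at-i)))
  member : g [ i ≔ + c ] ∈ boxes d a (suc l)
  member = ∈-concatMap⁺ (λ g → settings g i (d i)) (Any.map (λ { refl → ∈-map⁺ (λ c → g [ i ≔ + c ]) (∈-upTo⁺ c≤d) }) g∈)
  agree′ : ∀ k → a ℕ.< k → k ℕ.≤ i → (g [ i ≔ + c ]) k ≡ y k
  agree′ k a<k k≤i = by-cases (k ℕ.≟ i)
    where
    by-cases : Dec (k ≡ i) → (g [ i ≔ + c ]) k ≡ y k
    by-cases (yes refl) = trans (≔-same g i (+ c)) +c≡yi
    by-cases (no k≢i)   = trans (≔-other g (+ c) k≢i)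
      (agree k a<k (ℕₚ.≤-pred (subst (k ℕ.<_) (ℕₚ.+-suc a l) (ℕₚ.≤∧≢⇒< k≤i k≢i))))

interval? : {P : ℕ → Set} → (∀ k → Dec (P k)) → ∀ a b → Dec (∀ k → a ℕ.≤ k → k ℕ.< b → P k)
interval? P? a b = map′ (λ h k a≤k k<b → h {k} k<b a≤k) (λ h {k} k<b a≤k → h k a≤k k<b)
                        (ℕₚ.allUpTo? (λ k → (a ℕ.≤? k) →-dec P? k) b)

+1≤-cancelˡ : ∀ {M A B} → M ℤ.+ A ℤ.+ + 1 ℤ.≤ M ℤ.+ B → A ℤ.+ + 1 ℤ.≤ B
+1≤-cancelˡ {M} {A} {B} h = ℤΣ.+-cancelˡ-≤ M (subst (ℤ._≤ M ℤ.+ B) (ℤₚ.+-assoc M A (+ 1)) h)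

+1≤-cancelʳ : ∀ {M A B} → A ℤ.+ M ℤ.+ + 1 ℤ.≤ B ℤ.+ M → A ℤ.+ + 1 ℤ.≤ B
+1≤-cancelʳ {M} {A} {B} h =
  +1≤-cancelˡ {M} (subst₂ ℤ._≤_ (cong (ℤ._+ + 1) (ℤₚ.+-comm A M)) (ℤₚ.+-comm B M) h)

+1≤-from-larger-term : ∀ {A B u u′ C} → A ℤ.+ (u ℤ.+ C) ℤ.≤ B ℤ.+ (u′ ℤ.+ C) → u′ ℤ.+ + 1 ℤ.≤ u →
                       A ℤ.+ + 1 ℤ.≤ B
+1≤-from-larger-term {A} {B} {u} {u′} {C} h u′<u = ℤΣ.+-cancelʳ-≤ (u′ ℤ.+ C)
  (ℤₚ.≤-trans (ℤₚ.≤-trans (ℤₚ.≤-reflexive (regroup A u′ C)) (ℤₚ.+-monoʳ-≤ A (ℤₚ.+-monoˡ-≤ C u′<u))) h)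
  where
  regroup : ∀ A u′ C → A ℤ.+ + 1 ℤ.+ (u′ ℤ.+ C) ≡ A ℤ.+ (u′ ℤ.+ + 1 ℤ.+ C)
  regroup = solve-∀

telescope : ∀ al at au → al ℤ.- at ℤ.+ (at ℤ.- au) ≡ al ℤ.- au
telescope = solve-∀

suffix-from-tight-prefix : ∀ {Sx Qx Sy Py aw at al av} → Sx ℤ.+ Qx ≡ aw ℤ.- at → Qx ≡ al ℤ.- at →
  Sy ℤ.+ Py ≡ aw ℤ.- av → Py ℤ.≤ al ℤ.- av → Sx ℤ.≤ Sy
suffix-from-tight-prefix {Sx} {Qx} {Sy} {Py} {aw} {at} {al} {av} x-total x-tight y-total y-prefix =
  ℤΣ.+-cancelʳ-≤ Py (ℤₚ.≤-trans (ℤₚ.+-monoʳ-≤ Sx y-prefix) (ℤₚ.≤-reflexive same))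
  where
  open ≡-Reasoning
  same : Sx ℤ.+ (al ℤ.- av) ≡ Sy ℤ.+ Py
  same = begin
    Sx ℤ.+ (al ℤ.- av)                             ≡⟨ regroup Sx Qx al av ⟩
    Sx ℤ.+ Qx ℤ.- Qx ℤ.+ (al ℤ.- av)               ≡⟨ cong₂ (λ u z → u ℤ.- z ℤ.+ (al ℤ.- av)) x-total x-tight ⟩
    aw ℤ.- at ℤ.- (al ℤ.- at) ℤ.+ (al ℤ.- av)      ≡⟨ collapse aw at al av ⟩
    aw ℤ.- av                                      ≡⟨ sym y-total ⟩
    Sy ℤ.+ Py                                      ∎
    where
    regroup : ∀ Sx Qx al av → Sx ℤ.+ (al ℤ.- av) ≡ Sx ℤ.+ Qx ℤ.- Qx ℤ.+ (al ℤ.- av)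
    regroup = solve-∀
    collapse : ∀ aw at al av → aw ℤ.- at ℤ.- (al ℤ.- at) ℤ.+ (al ℤ.- av) ≡ aw ℤ.- av
    collapse = solve-∀

prefix-slack-from-suffix : ∀ {A Sy Sx Qx aw av at al} → A ℤ.+ Sy ≡ aw ℤ.- av → Sx ℤ.+ Qx ≡ aw ℤ.- at →
  Qx ℤ.≤ al ℤ.- at → Sx ℤ.+ + 1 ℤ.≤ Sy → A ℤ.+ + 1 ℤ.≤ al ℤ.- av
prefix-slack-from-suffix {A} {Sy} {Sx} {Qx} {aw} {av} {at} {al} y-total x-total x-prefix longer =
  ℤΣ.+-cancelʳ-≤ (aw ℤ.- at)
    (subst₂ ℤ._≤_ (trans (regroup A Sx Qx) (cong (λ u → A ℤ.+ + 1 ℤ.+ u) x-total))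
                  (trans (cong (ℤ._+ (al ℤ.- at)) y-total) (swap aw av al at))
                  (ℤₚ.+-mono-≤ (ℤₚ.+-monoʳ-≤ A longer) x-prefix))
  where
  regroup : ∀ A Sx Qx → A ℤ.+ (Sx ℤ.+ + 1) ℤ.+ Qx ≡ A ℤ.+ + 1 ℤ.+ (Sx ℤ.+ Qx)
  regroup = solve-∀
  swap : ∀ aw av al at → aw ℤ.- av ℤ.+ (al ℤ.- at) ≡ al ℤ.- av ℤ.+ (aw ℤ.- at)
  swap = solve-∀

within-length : ∀ {P Q k} → P ℕ.< k → k ℕ.≤ P ℕ.+ (Q ∸ P) → k ℕ.≤ Q
within-length {P} {Q} {k} P<k k≤ with P ℕ.≤? Q
... | yes P≤Q = subst (k ℕ.≤_) (ℕₚ.m+[n∸m]≡n P≤Q) k≤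
... | no P≰Q  = ⊥-elim (ℕₚ.<⇒≱ P<k (subst (k ℕ.≤_) empty k≤))
  where
  empty : P ℕ.+ (Q ∸ P) ≡ P
  empty = trans (cong (P ℕ.+_) (ℕₚ.m≤n⇒m∸n≡0 (ℕₚ.≰⇒≥ P≰Q))) (ℕₚ.+-identityʳ P)

≤pred⇒< : ∀ {l t w} → t ℕ.< w → l ℕ.≤ ℕ.pred w → l ℕ.< w
≤pred⇒< {w = suc w} _ l≤ = s≤s l≤

pred< : ∀ {v} → 1 ℕ.≤ v → v ∸ 1 ℕ.< v
pred< {suc v} _ = ℕₚ.≤-refl

pred<⇒≤ : ∀ {v l} → 1 ℕ.≤ v → v ∸ 1 ℕ.< l → v ℕ.≤ l
pred<⇒≤ {suc v} _ v<l = v<l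

module Nested (G : OrderedAbelianGroup) (I : Instance G) where
  open Instance I
  open OrderedAbelianGroup G using () renaming (_≤_ to _≤G_)

  Slack : ℕ → (ℕ → ℤ) → ℕ → Set
  Slack V y l = sumRange y (s (V ∸ 1)) (s l) ℤ.+ + 1 ℤ.≤ ā l ℤ.- ā (V ∸ 1)

  SlackOn : ℕ → ℕ → (ℕ → ℤ) → ℕ → ℕ → Set
  SlackOn V W y a b = ∀ l → V ℕ.≤ l → l ℕ.< W → a ℕ.≤ s l → s l ℕ.< b → Slack V y l

  no-slack-needed : ∀ {V W} z {a b} → b ℕ.≤ a → SlackOn V W z a b
  no-slack-needed z b≤a l _ _ a≤sl sl<b = ⊥-elim (ℕₚ.<⇒≱ (ℕₚ.≤-<-trans a≤sl sl<b) b≤a)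

  -- A transfer from i to j keeps a feasible y feasible if y_i ≥ 1, y_j < d_j and
  -- the nested constraints whose prefix gains the unit (those ending in [j, i)) have slack.
  transfer-feasible : ∀ {V W} y {i j} → i ≢ j → s (V ∸ 1) ℕ.< i → i ℕ.≤ s W →
    s (V ∸ 1) ℕ.< j → j ℕ.≤ s W → Feasible G I V W y →
    + 1 ℤ.≤ y i → y j ℤ.+ + 1 ℤ.≤ + d j → SlackOn V W y j i →
    Feasible G I V W (transfer y i j)
  transfer-feasible {V} {W} y {i} {j} i≢j p<i i≤ p<j j≤ (nested , total , box) 1≤yi yj<d slack =
    nested′ , trans (transfer-sum-both y i≢j p<i p<j i≤ j≤) total , box′
    where
    nested′ : ∀ l → V ℕ.≤ l → l ℕ.< W →
              sumRange (transfer y i j) (s (V ∸ 1)) (s l) ℤ.≤ ā l ℤ.- ā (V ∸ 1)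
    nested′ l V≤l l<W with transfer-sum y i≢j p<i p<j (s l)
    ... | inj₁ not-larger = ℤₚ.≤-trans not-larger (nested l V≤l l<W)
    ... | inj₂ (j≤ , <i , gained) rewrite gained = slack l V≤l l<W j≤ <i
    box′ : ∀ k → s (V ∸ 1) ℕ.< k → k ℕ.≤ s W → (+ 0 ℤ.≤ transfer y i j k) × (transfer y i j k ℤ.≤ + d k)
    box′ k p<k k≤ = by-cases (k ℕ.≟ i) (k ℕ.≟ j)
      where
      by-cases : Dec (k ≡ i) → Dec (k ≡ j) → (+ 0 ℤ.≤ transfer y i j k) × (transfer y i j k ℤ.≤ + d k)
      by-cases (yes refl) _ rewrite transfer-source y i j =
        ℤₚ.i≤j⇒0≤j-i 1≤yi , ℤₚ.≤-trans (ℤₚ.i-j≤i (y i) (+ 1)) (proj₂ (box i p<k k≤))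
      by-cases (no k≢i) (yes refl) rewrite transfer-target y i≢j =
        ℤₚ.≤-trans (proj₁ (box j p<k k≤)) (ℤₚ.i≤i+j (y j) (+ 1)) , yj<d
      by-cases (no k≢i) (no k≢j) rewrite transfer-other y k≢i k≢j = box k p<k k≤

  record ExchangePair (v w V W : ℕ) (x y : ℕ → ℤ) (a b : ℕ) : Set where
    field
      a≢b : a ≢ b
      xa<ya : x a ℤ.+ + 1 ℤ.≤ y a
      yb<xb : y b ℤ.+ + 1 ℤ.≤ x b
      y′-feasible : Feasible G I v w (transfer y a b)
      x′-feasible : Feasible G I V W (transfer x b a)

  exchange-feasible : ∀ {v w V W} x y {a b} → a ≢ b →
    s (v ∸ 1) ℕ.≤ s (V ∸ 1) → s W ℕ.≤ s w →
    s (V ∸ 1) ℕ.< a → a ℕ.≤ s W → s (V ∸ 1) ℕ.< b → b ℕ.≤ s W →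
    Feasible G I V W x → Feasible G I v w y →
    x a ℤ.+ + 1 ℤ.≤ y a → y b ℤ.+ + 1 ℤ.≤ x b →
    SlackOn V W x a b → SlackOn v w y b a →
    ExchangePair v w V W x y a b
  exchange-feasible {v} {w} {V} {W} x y {a} {b} a≢b inner-start inner-end P<a a≤ P<b b≤
                    x-feasible y-feasible xa<ya yb<xb x-slack y-slack = record
    { a≢b = a≢b ; xa<ya = xa<ya ; yb<xb = yb<xb
    ; y′-feasible = transfer-feasible y a≢b (widen P<a) (narrow a≤) (widen P<b) (narrow b≤) y-feasible
        (ℤₚ.≤-trans (ℤₚ.+-monoˡ-≤ (+ 1) (proj₁ (x-box a P<a a≤))) xa<ya)
        (ℤₚ.≤-trans yb<xb (proj₂ (x-box b P<b b≤))) y-slack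
    ; x′-feasible = transfer-feasible x (λ b≡a → a≢b (sym b≡a)) P<b b≤ P<a a≤ x-feasible
        (ℤₚ.≤-trans (ℤₚ.+-monoˡ-≤ (+ 1) (proj₁ (y-box b (widen P<b) (narrow b≤)))) yb<xb)
        (ℤₚ.≤-trans xa<ya (proj₂ (y-box a (widen P<a) (narrow a≤)))) x-slack
    }
    where
    x-box : ∀ k → s (V ∸ 1) ℕ.< k → k ℕ.≤ s W → (+ 0 ℤ.≤ x k) × (x k ℤ.≤ + d k)
    x-box = proj₂ (proj₂ x-feasible)
    y-box : ∀ k → s (v ∸ 1) ℕ.< k → k ℕ.≤ s w → (+ 0 ℤ.≤ y k) × (y k ℤ.≤ + d k)
    y-box = proj₂ (proj₂ y-feasible)
    widen : ∀ {k} → s (V ∸ 1) ℕ.< k → s (v ∸ 1) ℕ.< k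
    widen = ℕₚ.≤-<-trans inner-start
    narrow : ∀ {k} → k ℕ.≤ s W → k ℕ.≤ s w
    narrow k≤ = ℕₚ.≤-trans k≤ inner-end

  feasible? : ∀ V W y → Dec (Feasible G I V W y)
  feasible? V W y =
    interval? (λ l → sumRange y P (s l) ℤₚ.≤? ā l ℤ.- ā (V ∸ 1)) V W
    ×-dec (sumRange y P (s W) ℤₚ.≟ ā W ℤ.- ā (V ∸ 1))
    ×-dec map′ (λ h k P<k k≤ → h k P<k (s≤s k≤)) (λ h k P<k k< → h k P<k (ℕₚ.≤-pred k<))
               (interval? (λ k → (+ 0 ℤₚ.≤? y k) ×-dec (y k ℤₚ.≤? + d k)) (suc P) (suc (s W)))
    where
    P : ℕ
    P = s (V ∸ 1)

  cost-local : ∀ V W y z → (∀ k → s (V ∸ 1) ℕ.< k → k ℕ.≤ s W → y k ≡ z k) → cost G I V W y ≡ cost G I V W z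
  cost-local V W y z agree =
    GroupSums.Σ-cong G (λ k → f k (y k)) (λ k → f k (z k)) (s (V ∸ 1)) (s W) (λ k P<k k≤ → cong (f k) (agree k P<k k≤))

  module Breakpoints (s-increasing : ∀ i → i ℕ.< m → s i ℕ.< s (suc i)) where

    s-mono : ∀ {a b} → a ℕ.≤ b → b ℕ.≤ m → s a ℕ.≤ s b
    s-mono {b = zero}  z≤n _ = ℕₚ.≤-refl
    s-mono {a} {suc b} a≤ b<m with ℕₚ.m≤n⇒m<n∨m≡n a≤
    ... | inj₂ refl = ℕₚ.≤-refl
    ... | inj₁ a<   = ℕₚ.≤-trans (s-mono (ℕₚ.≤-pred a<) (ℕₚ.<⇒≤ b<m)) (ℕₚ.<⇒≤ (s-increasing b b<m))

    s-strict : ∀ {a b} → a ℕ.< b → b ℕ.≤ m → s a ℕ.< s b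
    s-strict {a} {suc b} (s≤s a≤b) b<m =
      ℕₚ.≤-<-trans (s-mono a≤b (ℕₚ.<⇒≤ b<m)) (s-increasing b b<m)

    s-reflect : ∀ {a b} → s a ℕ.< s b → a ℕ.≤ m → a ℕ.< b
    s-reflect {a} {b} sa<sb a≤m with a ℕ.<? b
    ... | yes a<b = a<b
    ... | no a≮b  = ⊥-elim (ℕₚ.<⇒≱ sa<sb (s-mono (ℕₚ.≮⇒≥ a≮b) a≤m))

    feasible-local : ∀ {V W} y z → W ℕ.≤ m → (∀ k → s (V ∸ 1) ℕ.< k → k ℕ.≤ s W → y k ≡ z k) →
                     Feasible G I V W z → Feasible G I V W y
    feasible-local {V} {W} y z W≤m agree (nested , total , box) =
      (λ l V≤l l<W → subst (ℤ._≤ _) (sym (sum-cong y z P (s l) (λ k P<k k≤ → agree k P<k (ℕₚ.≤-trans k≤ (sl≤sW l<W)))))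
                                    (nested l V≤l l<W))
      , trans (sum-cong y z P (s W) agree) total
      , λ k P<k k≤ → subst (λ u → (+ 0 ℤ.≤ u) × (u ℤ.≤ + d k)) (sym (agree k P<k k≤)) (box k P<k k≤)
      where
      P : ℕ
      P = s (V ∸ 1)
      sl≤sW : ∀ {l} → l ℕ.< W → s l ℕ.≤ s W
      sl≤sW l<W = s-mono (ℕₚ.<⇒≤ l<W) W≤m

    -- A subproblem with a feasible solution has an optimal one: its feasible
    -- solutions are, up to the irrelevant coordinates, among the finitely many
    -- boxes, and the cheapest feasible box is optimal.
    optimum-exists : ∀ {V W} z → W ℕ.≤ m → Feasible G I V W z → Σ (ℕ → ℤ) (Optimal G I V W)
    optimum-exists {V} {W} z W≤m z-feasible = y* , y*-feasible , y*-minimal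
      where
      open import Data.List.Extrema (GroupSums.totalOrder G) using (argmin; argmin-sel; f[argmin]≤f[xs])
      P : ℕ
      P = s (V ∸ 1)
      candidates : List (ℕ → ℤ)
      candidates = filter (feasible? V W) (boxes d P (s W ∸ P))
      y* : ℕ → ℤ
      y* = argmin (cost G I V W) z candidates
      y*-feasible : Feasible G I V W y*
      y*-feasible with argmin-sel (cost G I V W) z candidates
      ... | inj₁ y*≡z  = subst (Feasible G I V W) (sym y*≡z) z-feasible
      ... | inj₂ y*∈   = proj₂ (∈-filter⁻ (feasible? V W) {xs = boxes d P (s W ∸ P)} y*∈)
      representative : ∀ y → Feasible G I V W y →
        Σ (ℕ → ℤ) λ g → g ∈ candidates × (∀ k → P ℕ.< k → k ℕ.≤ s W → g k ≡ y k)
      representative y y-feasible with boxes-complete d P (s W ∸ P) y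
        (λ k P<k k≤ → proj₂ (proj₂ y-feasible) k P<k (within-length P<k k≤))
      ... | g , g∈ , agree = g , ∈-filter⁺ (feasible? V W) g∈ (feasible-local g y W≤m agree′ y-feasible) , agree′
        where
        agree′ : ∀ k → P ℕ.< k → k ℕ.≤ s W → g k ≡ y k
        agree′ k P<k k≤ = agree k P<k (subst (k ℕ.≤_) (sym (ℕₚ.m+[n∸m]≡n (ℕₚ.<⇒≤ (ℕₚ.<-≤-trans P<k k≤)))) k≤)
      y*-minimal : ∀ y → Feasible G I V W y → cost G I V W y* ≤G cost G I V W y
      y*-minimal y y-feasible with representative y y-feasible
      ... | g , g∈ , agree = subst (cost G I V W y* ≤G_) (cost-local V W g y agree)
                               (All.lookup (f[argmin]≤f[xs] z candidates) g∈)

    module Blocks (v t w : ℕ) (1≤v : 1 ℕ.≤ v) (v≤t : v ℕ.≤ t) (t<w : t ℕ.< w) (w≤m : w ℕ.≤ m) where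
      p r q : ℕ
      p = s (v ∸ 1)
      r = s t
      q = s w

      t≤m : t ℕ.≤ m
      t≤m = ℕₚ.≤-trans (ℕₚ.<⇒≤ t<w) w≤m

      v-1<v : v ∸ 1 ℕ.< v
      v-1<v = pred< 1≤v

      v≤ : ∀ {l} → v ∸ 1 ℕ.< l → v ℕ.≤ l
      v≤ = pred<⇒≤ 1≤v

      p<r : p ℕ.< r
      p<r = s-strict (ℕₚ.<-≤-trans v-1<v v≤t) t≤m

      r<q : r ℕ.< q
      r<q = s-strict t<w w≤m

      p≤ : ∀ {l} → v ℕ.≤ l → l ℕ.≤ m → p ℕ.≤ s l
      p≤ v≤l l≤m = s-mono (ℕₚ.≤-trans (ℕₚ.m∸n≤m v 1) v≤l) l≤m

      module LeftStep (x y : ℕ → ℤ) (x-feasible : Feasible G I v t x) (y-feasible : Feasible G I v w y) where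

        LeftPartner : ℕ → Set
        LeftPartner i = Σ ℕ λ j → p ℕ.< j × j ℕ.≤ r × ExchangePair v w v t x y i j

        private
          bound : ℕ → ℤ
          bound l = ā l ℤ.- ā (v ∸ 1)

          x-nested : ∀ l → v ℕ.≤ l → l ℕ.< t → sumRange x p (s l) ℤ.≤ bound l
          x-nested = proj₁ x-feasible
          x-total : sumRange x p r ≡ bound t
          x-total = proj₁ (proj₂ x-feasible)
          y-nested : ∀ l → v ℕ.≤ l → l ℕ.< w → sumRange y p (s l) ℤ.≤ bound l
          y-nested = proj₁ y-feasible

          partner : ∀ {i j} → i ≢ j → p ℕ.< i → i ℕ.≤ r → p ℕ.< j → j ℕ.≤ r →
            x i ℤ.+ + 1 ℤ.≤ y i → y j ℤ.+ + 1 ℤ.≤ x j →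
            SlackOn v t x i j → SlackOn v w y j i → LeftPartner i
          partner {j = j} i≢j p<i i≤r p<j j≤r xi<yi yj<xj x-slack y-slack =
            j , p<j , j≤r , exchange-feasible x y i≢j ℕₚ.≤-refl (s-mono (ℕₚ.<⇒≤ t<w) w≤m)
                              p<i i≤r p<j j≤r x-feasible y-feasible xi<yi yj<xj x-slack y-slack

        -- Constraint l ends at or after i and is tight for x (or is x's final
        -- constraint l = t, which is tight by definition).
        Barrier : ℕ → ℕ → Set
        Barrier i l = i ℕ.≤ s l × (l ≡ t ⊎ sumRange x p (s l) ≡ bound l)

        barrier? : ∀ i l → Dec (Barrier i l)
        barrier? i l = (i ℕ.≤? s l) ×-dec ((l ℕ.≟ t) ⊎-dec (sumRange x p (s l) ℤₚ.≟ bound l))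

        -- Case 1 (equal sums before i), given the first barrier l after i: on
        -- (i, s[l]] y sums to less than x, so y falls short of x at some j there,
        -- and the constraints of x ending in [i, j) are not tight.
        before-first-barrier : ∀ {i′ l} → p ℕ.< suc i′ → suc i′ ℕ.≤ r → x (suc i′) ℤ.+ + 1 ℤ.≤ y (suc i′) →
          sumRange y p i′ ≡ sumRange x p i′ → v ∸ 1 ℕ.< l → l ℕ.≤ t → Barrier (suc i′) l →
          (∀ l′ → v ∸ 1 ℕ.< l′ → l′ ℕ.< l → ¬ Barrier (suc i′) l′) → LeftPartner (suc i′)
        before-first-barrier {i′} {l} p<i i≤r xi<yi equal-before v-1<l l≤t (i≤sl , tight) earlier =
          shortfall-at (least-failure (λ k → x k ℤ.≤ y k) (λ k → x k ℤₚ.≤? y k) i (s l))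
          where
          i : ℕ
          i = suc i′
          v≤l : v ℕ.≤ l
          v≤l = v≤ v-1<l
          l<w : l ℕ.< w
          l<w = ℕₚ.≤-<-trans l≤t t<w
          y≤x-at-barrier : sumRange y p (s l) ℤ.≤ sumRange x p (s l)
          y≤x-at-barrier = from-tight tight
            where
            from-tight : l ≡ t ⊎ sumRange x p (s l) ≡ bound l → sumRange y p (s l) ℤ.≤ sumRange x p (s l)
            from-tight (inj₁ refl)    = ℤₚ.≤-trans (y-nested t v≤t t<w) (ℤₚ.≤-reflexive (sym x-total))
            from-tight (inj₂ x-tight) = ℤₚ.≤-trans (y-nested l v≤l l<w) (ℤₚ.≤-reflexive (sym x-tight))
          split : ∀ z → sumRange z p (s l) ≡ sumRange z i (s l) ℤ.+ (z i ℤ.+ sumRange z p i′)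
          split z = trans (sum-split z (ℕₚ.<⇒≤ p<i) i≤sl)
                          (cong (λ u → sumRange z i (s l) ℤ.+ u) (sum-last z (ℕₚ.≤-pred p<i)))
          shortfall : sumRange y i (s l) ℤ.+ + 1 ℤ.≤ sumRange x i (s l)
          shortfall = +1≤-from-larger-term {sumRange y i (s l)} {sumRange x i (s l)} {y i} {x i} {sumRange y p i′}
            (subst₂ ℤ._≤_ (split y)
                    (trans (split x) (cong (λ u → sumRange x i (s l) ℤ.+ (x i ℤ.+ u)) (sym equal-before)))
                    y≤x-at-barrier)
            xi<yi
          shortfall-at : LeastFailure (λ k → x k ℤ.≤ y k) i (s l) → LeftPartner i
          shortfall-at (inj₁ x≤y) = ⊥-elim (+1≤⇒≱ shortfall (sum-mono x y i (s l) x≤y))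
          shortfall-at (inj₂ (j , i<j , j≤sl , x≰y , _)) =
            partner (ℕₚ.<⇒≢ i<j) p<i i≤r (ℕₚ.<-trans p<i i<j) j≤r xi<yi (+1≤-from-≰ x≰y) x-slack
                    (no-slack-needed y (ℕₚ.<⇒≤ i<j))
            where
            j≤r : j ℕ.≤ r
            j≤r = ℕₚ.≤-trans j≤sl (s-mono l≤t t≤m)
            x-slack : SlackOn v t x i j
            x-slack l′ v≤l′ l′<t i≤sl′ sl′<j =
              +1≤-from-≢ (x-nested l′ v≤l′ l′<t)
                (λ tight′ → earlier l′ (ℕₚ.<-≤-trans v-1<v v≤l′)
                              (s-reflect (ℕₚ.<-≤-trans sl′<j j≤sl) (ℕₚ.≤-trans (ℕₚ.<⇒≤ l′<t) t≤m))
                              (i≤sl′ , inj₂ tight′))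

        -- Case 1: equal sums before i.  The first barrier after i exists since t is one.
        balanced : ∀ {i′} → p ℕ.< suc i′ → suc i′ ℕ.≤ r → x (suc i′) ℤ.+ + 1 ℤ.≤ y (suc i′) →
          sumRange y p i′ ≡ sumRange x p i′ → LeftPartner (suc i′)
        balanced {i′} p<i i≤r xi<yi equal-before =
          first-barrier (least-failure (λ l → ¬ Barrier i l) (λ l → ¬? (barrier? i l)) (v ∸ 1) t)
          where
          i : ℕ
          i = suc i′
          first-barrier : LeastFailure (λ l → ¬ Barrier i l) (v ∸ 1) t → LeftPartner i
          first-barrier (inj₁ none) = ⊥-elim (none t (ℕₚ.<-≤-trans v-1<v v≤t) ℕₚ.≤-refl (i≤r , inj₁ refl))
          first-barrier (inj₂ (l , v-1<l , l≤t , ¬¬barrier , earlier)) =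
            before-first-barrier p<i i≤r xi<yi equal-before v-1<l l≤t
              (decidable-stable (barrier? i l) ¬¬barrier) earlier

        -- Case 2: y sums to less than x before i (it is ≤ x there by the choice of i).
        -- Take the last j < i where y falls short of x; y = x on (j, i), so y's
        -- constraints ending in [j, i) inherit slack from x's.
        unbalanced : ∀ {i′} → p ℕ.< suc i′ → suc i′ ℕ.≤ r → x (suc i′) ℤ.+ + 1 ℤ.≤ y (suc i′) →
          (∀ k → p ℕ.< k → k ℕ.< suc i′ → y k ℤ.≤ x k) →
          sumRange y p i′ ≢ sumRange x p i′ → LeftPartner (suc i′)
        unbalanced {i′} p<i i≤r xi<yi below unequal =
          last-shortfall (greatest-failure (λ k → x k ℤ.≤ y k) (λ k → x k ℤₚ.≤? y k) p i′)
          where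
          i : ℕ
          i = suc i′
          shortfall : sumRange y p i′ ℤ.+ + 1 ℤ.≤ sumRange x p i′
          shortfall = +1≤-from-≢ (sum-mono y x p i′ (λ k p<k k≤i′ → below k p<k (s≤s k≤i′))) unequal
          last-shortfall : GreatestFailure (λ k → x k ℤ.≤ y k) p i′ → LeftPartner i
          last-shortfall (inj₁ x≤y) = ⊥-elim (+1≤⇒≱ shortfall (sum-mono x y p i′ x≤y))
          last-shortfall (inj₂ (j , p<j , j≤i′ , x≰y , after)) =
            partner (λ i≡j → ℕₚ.<-irrefl (sym i≡j) (s≤s j≤i′)) p<i i≤r p<j j≤r xi<yi (+1≤-from-≰ x≰y)
                    (no-slack-needed x (ℕₚ.<⇒≤ (s≤s j≤i′))) y-slack
            where
            j≤r : j ℕ.≤ r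
            j≤r = ℕₚ.≤-trans j≤i′ (ℕₚ.≤-trans (ℕₚ.n≤1+n i′) i≤r)
            y-slack : SlackOn v w y j i
            y-slack l v≤l l<w j≤sl sl<i =
              ℤₚ.≤-trans (+1≤-cancelˡ {sumRange y (s l) i′} (subst₂ ℤ._≤_ (cong (ℤ._+ + 1) (split y))
                                                    (trans (split x) (cong (ℤ._+ sumRange x p (s l)) (sym same-middle)))
                                                    shortfall))
                         (x-nested l v≤l l<t)
              where
              l≤m : l ℕ.≤ m
              l≤m = ℕₚ.≤-trans (ℕₚ.<⇒≤ l<w) w≤m
              l<t : l ℕ.< t
              l<t = s-reflect (ℕₚ.<-≤-trans sl<i i≤r) l≤m
              split : ∀ z → sumRange z p i′ ≡ sumRange z (s l) i′ ℤ.+ sumRange z p (s l)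
              split z = sum-split z (p≤ v≤l l≤m) (ℕₚ.≤-pred sl<i)
              same-middle : sumRange y (s l) i′ ≡ sumRange x (s l) i′
              same-middle = sum-cong y x (s l) i′ (λ k sl<k k≤i′ → ℤₚ.≤-antisym
                (below k (ℕₚ.≤-<-trans (p≤ v≤l l≤m) sl<k) (s≤s k≤i′))
                (after k (ℕₚ.≤-<-trans j≤sl sl<k) k≤i′))

        left-step : ∀ i → p ℕ.< i → i ℕ.≤ r → x i ℤ.+ + 1 ℤ.≤ y i →
                    (∀ k → p ℕ.< k → k ℕ.< i → y k ℤ.≤ x k) → LeftPartner i
        left-step (suc i′) p<i i≤r xi<yi below with sumRange y p i′ ℤₚ.≟ sumRange x p i′
        ... | yes equal  = balanced p<i i≤r xi<yi equal
        ... | no unequal = unbalanced p<i i≤r xi<yi below unequal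

      module RightStep (x y : ℕ → ℤ) (x-feasible : Feasible G I (suc t) w x)
                       (y-feasible : Feasible G I v w y) where

        RightPartner : ℕ → Set
        RightPartner i = Σ ℕ λ j → r ℕ.< j × j ℕ.≤ q × ExchangePair v w (suc t) w x y j i

        private
          x-nested : ∀ l → suc t ℕ.≤ l → l ℕ.< w → sumRange x r (s l) ℤ.≤ ā l ℤ.- ā t
          x-nested = proj₁ x-feasible
          x-total : sumRange x r q ≡ ā w ℤ.- ā t
          x-total = proj₁ (proj₂ x-feasible)
          y-nested : ∀ l → v ℕ.≤ l → l ℕ.< w → sumRange y p (s l) ℤ.≤ ā l ℤ.- ā (v ∸ 1)
          y-nested = proj₁ y-feasible
          y-total : sumRange y p q ≡ ā w ℤ.- ā (v ∸ 1)
          y-total = proj₁ (proj₂ y-feasible)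

          partner : ∀ {i j} → j ≢ i → r ℕ.< i → i ℕ.≤ q → r ℕ.< j → j ℕ.≤ q →
            x j ℤ.+ + 1 ℤ.≤ y j → y i ℤ.+ + 1 ℤ.≤ x i →
            SlackOn (suc t) w x j i → SlackOn v w y i j → RightPartner i
          partner {j = j} j≢i r<i i≤q r<j j≤q xj<yj yi<xi x-slack y-slack =
            j , r<j , j≤q , exchange-feasible x y j≢i (ℕₚ.<⇒≤ p<r) ℕₚ.≤-refl
                              r<j j≤q r<i i≤q x-feasible y-feasible xj<yj yi<xi x-slack y-slack

          x-split-total : ∀ {l} → t ℕ.≤ l → l ℕ.< w →
            sumRange x (s l) q ℤ.+ sumRange x r (s l) ≡ ā w ℤ.- ā t
          x-split-total {l} t≤l l<w =
            trans (sym (sum-split x (s-mono t≤l l≤m) (s-mono (ℕₚ.<⇒≤ l<w) w≤m))) x-total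
            where
            l≤m : l ℕ.≤ m
            l≤m = ℕₚ.≤-trans (ℕₚ.<⇒≤ l<w) w≤m
          y-split-total : ∀ {l} → v ℕ.≤ l → l ℕ.< w →
            sumRange y p (s l) ℤ.+ sumRange y (s l) q ≡ ā w ℤ.- ā (v ∸ 1)
          y-split-total {l} v≤l l<w =
            trans (ℤₚ.+-comm (sumRange y p (s l)) (sumRange y (s l) q))
                  (trans (sym (sum-split y (p≤ v≤l l≤m) (s-mono (ℕₚ.<⇒≤ l<w) w≤m))) y-total)
            where
            l≤m : l ℕ.≤ m
            l≤m = ℕₚ.≤-trans (ℕₚ.<⇒≤ l<w) w≤m

        -- Case 1: after i, y sums to more than x (it is ≥ x there by the choice
        -- of i).  Take the first j > i where y exceeds x; y = x on (i, j), so the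
        -- constraints of y ending in [i, j) have slack, x's total being fixed.
        surplus-after : ∀ {i} → r ℕ.< i → i ℕ.≤ q → y i ℤ.+ + 1 ℤ.≤ x i →
          (∀ k → i ℕ.< k → k ℕ.≤ q → x k ℤ.≤ y k) → sumRange y i q ≢ sumRange x i q → RightPartner i
        surplus-after {i} r<i i≤q yi<xi after unequal =
          first-surplus (least-failure (λ k → y k ℤ.≤ x k) (λ k → y k ℤₚ.≤? x k) i q)
          where
          surplus : sumRange x i q ℤ.+ + 1 ℤ.≤ sumRange y i q
          surplus = +1≤-from-≢ (sum-mono x y i q after) (λ e → unequal (sym e))
          first-surplus : LeastFailure (λ k → y k ℤ.≤ x k) i q → RightPartner i
          first-surplus (inj₁ y≤x) = ⊥-elim (+1≤⇒≱ surplus (sum-mono y x i q y≤x))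
          first-surplus (inj₂ (j , i<j , j≤q , y≰x , before)) =
            partner (λ j≡i → ℕₚ.<-irrefl (sym j≡i) i<j) r<i i≤q (ℕₚ.<-trans r<i i<j) j≤q (+1≤-from-≰ y≰x) yi<xi
                    (no-slack-needed x (ℕₚ.<⇒≤ i<j)) y-slack
            where
            y-slack : SlackOn v w y i j
            y-slack l v≤l l<w i≤sl sl<j =
              prefix-slack-from-suffix {sumRange y p (s l)} {sumRange y (s l) q} {sumRange x (s l) q}
                                       {sumRange x r (s l)} {ā w} {ā (v ∸ 1)} {ā t} {ā l} (y-split-total v≤l l<w) (x-split-total (ℕₚ.<⇒≤ t<l) l<w)
                                       (x-nested l t<l l<w) longer
              where
              l≤m : l ℕ.≤ m
              l≤m = ℕₚ.≤-trans (ℕₚ.<⇒≤ l<w) w≤m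
              t<l : t ℕ.< l
              t<l = s-reflect (ℕₚ.<-≤-trans r<i i≤sl) t≤m
              split : ∀ z → sumRange z i q ≡ sumRange z (s l) q ℤ.+ sumRange z i (s l)
              split z = sum-split z i≤sl (s-mono (ℕₚ.<⇒≤ l<w) w≤m)
              same-middle : sumRange x i (s l) ≡ sumRange y i (s l)
              same-middle = sum-cong x y i (s l) (λ k i<k k≤sl → ℤₚ.≤-antisym
                (after k i<k (ℕₚ.≤-trans k≤sl (s-mono (ℕₚ.<⇒≤ l<w) w≤m)))
                (before k i<k (ℕₚ.≤-<-trans k≤sl sl<j)))
              longer : sumRange x (s l) q ℤ.+ + 1 ℤ.≤ sumRange y (s l) q
              longer = +1≤-cancelʳ {sumRange y i (s l)} {sumRange x (s l) q} {sumRange y (s l) q}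
                (subst₂ ℤ._≤_ (cong (ℤ._+ + 1) (trans (split x) (cong (λ u → sumRange x (s l) q ℤ.+ u) same-middle)))
                              (split y) surplus)

        -- Constraint l of x's problem ends before i and is tight for x (for l = t
        -- this is the empty prefix, which is tight by definition).
        Barrier : ℕ → ℕ → Set
        Barrier i l = s l ℕ.< i × sumRange x r (s l) ≡ ā l ℤ.- ā t

        barrier? : ∀ i l → Dec (Barrier i l)
        barrier? i l = (s l ℕ.<? i) ×-dec (sumRange x r (s l) ℤₚ.≟ ā l ℤ.- ā t)

        -- Case 2 (equal sums after i), given the last barrier l before i: on
        -- (s[l], i) x sums to less than y, so y exceeds x at some j there, and the
        -- constraints of x ending in [j, i) are not tight.
        after-last-barrier : ∀ {i′ l} → r ℕ.< suc i′ → suc i′ ℕ.≤ q → y (suc i′) ℤ.+ + 1 ℤ.≤ x (suc i′) →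
          sumRange y (suc i′) q ≡ sumRange x (suc i′) q → t ℕ.≤ l → l ℕ.< w → Barrier (suc i′) l →
          (∀ l′ → l ℕ.< l′ → l′ ℕ.≤ ℕ.pred w → ¬ Barrier (suc i′) l′) → RightPartner (suc i′)
        after-last-barrier {i′} {l} r<i i≤q yi<xi equal-after t≤l l<w (sl<i , tight) later =
          surplus-at (least-failure (λ k → y k ℤ.≤ x k) (λ k → y k ℤₚ.≤? x k) (s l) i′)
          where
          i : ℕ
          i = suc i′
          l≤m : l ℕ.≤ m
          l≤m = ℕₚ.≤-trans (ℕₚ.<⇒≤ l<w) w≤m
          v≤l : v ℕ.≤ l
          v≤l = ℕₚ.≤-trans v≤t t≤l
          x≤y-after-barrier : sumRange x (s l) q ℤ.≤ sumRange y (s l) q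
          x≤y-after-barrier =
            suffix-from-tight-prefix {sumRange x (s l) q} {sumRange x r (s l)} {sumRange y (s l) q}
                                     {sumRange y p (s l)} {ā w} {ā t} {ā l} {ā (v ∸ 1)}
              (x-split-total t≤l l<w) tight
              (trans (ℤₚ.+-comm (sumRange y (s l) q) (sumRange y p (s l))) (y-split-total v≤l l<w))
              (y-nested l v≤l l<w)
          split : ∀ z → sumRange z (s l) q ≡ sumRange z (s l) i′ ℤ.+ (z i ℤ.+ sumRange z i q)
          split z = begin
            sumRange z (s l) q                                   ≡⟨ sum-split z (ℕₚ.≤-pred sl<i) i′≤q ⟩
            sumRange z i′ q ℤ.+ sumRange z (s l) i′              ≡⟨ cong (ℤ._+ sumRange z (s l) i′)
                                                                      (sum-split z (ℕₚ.n≤1+n i′) i≤q) ⟩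
            sumRange z i q ℤ.+ sumRange z i′ i ℤ.+ sumRange z (s l) i′
                                                                 ≡⟨ cong (λ u → sumRange z i q ℤ.+ u ℤ.+ sumRange z (s l) i′)
                                                                      (sum-single z i′) ⟩
            sumRange z i q ℤ.+ z i ℤ.+ sumRange z (s l) i′      ≡⟨ rotate (sumRange z i q) (z i) (sumRange z (s l) i′) ⟩
            sumRange z (s l) i′ ℤ.+ (z i ℤ.+ sumRange z i q)    ∎
            where
            open ≡-Reasoning
            i′≤q : i′ ℕ.≤ q
            i′≤q = ℕₚ.≤-trans (ℕₚ.n≤1+n i′) i≤q
            rotate : ∀ a b c → a ℤ.+ b ℤ.+ c ≡ c ℤ.+ (b ℤ.+ a)
            rotate = solve-∀
          surplus : sumRange x (s l) i′ ℤ.+ + 1 ℤ.≤ sumRange y (s l) i′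
          surplus = +1≤-from-larger-term {sumRange x (s l) i′} {sumRange y (s l) i′} {x i} {y i} {sumRange y i q}
            (subst₂ ℤ._≤_ (trans (split x) (cong (λ u → sumRange x (s l) i′ ℤ.+ (x i ℤ.+ u)) (sym equal-after)))
                          (split y) x≤y-after-barrier)
            yi<xi
          surplus-at : LeastFailure (λ k → y k ℤ.≤ x k) (s l) i′ → RightPartner i
          surplus-at (inj₁ y≤x) = ⊥-elim (+1≤⇒≱ surplus (sum-mono y x (s l) i′ y≤x))
          surplus-at (inj₂ (j , sl<j , j≤i′ , y≰x , _)) =
            partner (λ j≡i → ℕₚ.<-irrefl j≡i (s≤s j≤i′)) r<i i≤q r<j j≤q (+1≤-from-≰ y≰x) yi<xi
                    x-slack (no-slack-needed y (ℕₚ.<⇒≤ (s≤s j≤i′)))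
            where
            r<j : r ℕ.< j
            r<j = ℕₚ.≤-<-trans (s-mono t≤l l≤m) sl<j
            j≤q : j ℕ.≤ q
            j≤q = ℕₚ.≤-trans (ℕₚ.≤-trans j≤i′ (ℕₚ.n≤1+n i′)) i≤q
            x-slack : SlackOn (suc t) w x j i
            x-slack l′ t<l′ l′<w j≤sl′ sl′<i =
              +1≤-from-≢ (x-nested l′ t<l′ l′<w)
                (λ tight′ → later l′ (s-reflect (ℕₚ.<-≤-trans sl<j j≤sl′) l≤m) (ℕₚ.<⇒≤pred l′<w) (sl′<i , tight′))

        -- Case 2: equal sums after i.  The last barrier before i exists since t is one.
        balanced-after : ∀ {i′} → r ℕ.< suc i′ → suc i′ ℕ.≤ q → y (suc i′) ℤ.+ + 1 ℤ.≤ x (suc i′) →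
          sumRange y (suc i′) q ≡ sumRange x (suc i′) q → RightPartner (suc i′)
        balanced-after {i′} r<i i≤q yi<xi equal-after =
          last-barrier (greatest-failure (λ l → ¬ Barrier i l) (λ l → ¬? (barrier? i l)) t (ℕ.pred w))
          where
          i : ℕ
          i = suc i′
          t-barrier : Barrier i t
          t-barrier = r<i , trans (sum-empty x r) (sym (ℤₚ.+-inverseʳ (ā t)))
          last-barrier : GreatestFailure (λ l → ¬ Barrier i l) t (ℕ.pred w) → RightPartner i
          last-barrier (inj₁ none-later) =
            after-last-barrier r<i i≤q yi<xi equal-after ℕₚ.≤-refl t<w t-barrier none-later
          last-barrier (inj₂ (l , t<l , l≤w-1 , ¬¬barrier , later)) =
            after-last-barrier r<i i≤q yi<xi equal-after (ℕₚ.<⇒≤ t<l) (≤pred⇒< t<w l≤w-1)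
              (decidable-stable (barrier? i l) ¬¬barrier) later

        right-step : ∀ i → r ℕ.< i → i ℕ.≤ q → y i ℤ.+ + 1 ℤ.≤ x i →
                     (∀ k → i ℕ.< k → k ℕ.≤ q → x k ℤ.≤ y k) → RightPartner i
        right-step (suc i′) r<i i≤q yi<xi after with sumRange y (suc i′) q ℤₚ.≟ sumRange x (suc i′) q
        ... | yes equal  = balanced-after r<i i≤q yi<xi equal
        ... | no unequal = surplus-after r<i i≤q yi<xi after unequal

      module Descent (s[m]≡n : s m ≡ n)
                     (convex : ∀ i → 1 ℕ.≤ i → i ℕ.≤ n → DiscretelyConvexOn G (d i) (f i))
                     (x↓ x↑ : ℕ → ℤ) (x↓-optimal : Optimal G I v t x↓) (x↑-optimal : Optimal G I (suc t) w x↑)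
                     where
        open Convexity G
        open GroupSums G using () renaming (≤-refl to ≤G-refl; ≤-trans to ≤G-trans)

        Below↓ : (ℕ → ℤ) → Set
        Below↓ y = ∀ k → p ℕ.< k → k ℕ.≤ r → y k ℤ.≤ x↓ k

        Above↑ : (ℕ → ℤ) → Set
        Above↑ y = ∀ k → r ℕ.< k → k ℕ.≤ q → x↑ k ℤ.≤ y k

        Improvement : ((ℕ → ℤ) → Set) → (ℕ → ℤ) → Set
        Improvement P y = Σ (ℕ → ℤ) λ y′ → Feasible G I v w y′ × cost G I v w y′ ≤G cost G I v w y × P y′

        private
          q≤n : q ℕ.≤ n
          q≤n = subst (q ℕ.≤_) s[m]≡n (s-mono w≤m ℕₚ.≤-refl)

          convex-in : ∀ {k} → p ℕ.< k → k ℕ.≤ q → DiscretelyConvexOn G (d k) (f k)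
          convex-in p<k k≤q = convex _ (ℕₚ.≤-trans (s≤s z≤n) p<k) (ℕₚ.≤-trans k≤q q≤n)

        exchange-of-pair : ∀ {V W x y a b} → ExchangePair v w V W x y a b →
          Feasible G I V W x → Feasible G I v w y → p ℕ.≤ s (V ∸ 1) → s W ℕ.≤ q →
          s (V ∸ 1) ℕ.< a → a ℕ.≤ s W → s (V ∸ 1) ℕ.< b → b ℕ.≤ s W →
          Exchange f d y x p q (s (V ∸ 1)) (s W) a b
        exchange-of-pair {V} {W} {x} {y} pair x-feasible y-feasible inner-start inner-end P<a a≤W P<b b≤W = record
          { i≢j = a≢b ; ay<i = widen P<a ; i≤by = narrow a≤W ; ay<j = widen P<b ; j≤by = narrow b≤W
          ; ax<i = P<a ; i≤bx = a≤W ; ax<j = P<b ; j≤bx = b≤W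
          ; convex-i = convex-in (widen P<a) (narrow a≤W) ; convex-j = convex-in (widen P<b) (narrow b≤W)
          ; 0≤xi = proj₁ (x-box _ P<a a≤W) ; xi<yi = xa<ya ; yi≤d = proj₂ (y-box _ (widen P<a) (narrow a≤W))
          ; 0≤yj = proj₁ (y-box _ (widen P<b) (narrow b≤W)) ; yj<xj = yb<xb ; xj≤d = proj₂ (x-box _ P<b b≤W)
          }
          where
          open ExchangePair pair
          x-box : ∀ k → s (V ∸ 1) ℕ.< k → k ℕ.≤ s W → (+ 0 ℤ.≤ x k) × (x k ℤ.≤ + d k)
          x-box = proj₂ (proj₂ x-feasible)
          y-box : ∀ k → p ℕ.< k → k ℕ.≤ q → (+ 0 ℤ.≤ y k) × (y k ℤ.≤ + d k)
          y-box = proj₂ (proj₂ y-feasible)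
          widen : ∀ {k} → s (V ∸ 1) ℕ.< k → p ℕ.< k
          widen = ℕₚ.≤-<-trans inner-start
          narrow : ∀ {k} → k ℕ.≤ s W → k ℕ.≤ q
          narrow k≤ = ℕₚ.≤-trans k≤ inner-end

        private
          x↓-feasible : Feasible G I v t x↓
          x↓-feasible = proj₁ x↓-optimal
          x↑-feasible : Feasible G I (suc t) w x↑
          x↑-feasible = proj₁ x↑-optimal

        left-exchange : ∀ y → Feasible G I v w y → ∀ {i} → p ℕ.< i → i ℕ.≤ r → x↓ i ℤ.+ + 1 ℤ.≤ y i →
          (∀ k → p ℕ.< k → k ℕ.< i → y k ℤ.≤ x↓ k) →
          Σ (ℕ → ℤ) λ y′ → Feasible G I v w y′ × cost G I v w y′ ≤G cost G I v w y ×
                           distance x↓ y′ p r ℕ.< distance x↓ y p r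
        left-exchange y y-feasible {i} p<i i≤r xi<yi below
          with LeftStep.left-step x↓ y x↓-feasible y-feasible i p<i i≤r xi<yi below
        ... | j , p<j , j≤r , pair =
          transfer y i j , y′-feasible ,
          exchange-improves (exchange-of-pair pair x↓-feasible y-feasible ℕₚ.≤-refl (ℕₚ.<⇒≤ r<q) p<i i≤r p<j j≤r)
                            (proj₂ x↓-optimal _ x′-feasible) ,
          transfer-closer x↓ y a≢b p<i i≤r p<j j≤r xa<ya yb<xb
          where open ExchangePair pair

        right-exchange : ∀ y → Feasible G I v w y → ∀ {i} → r ℕ.< i → i ℕ.≤ q → y i ℤ.+ + 1 ℤ.≤ x↑ i →
          (∀ k → i ℕ.< k → k ℕ.≤ q → x↑ k ℤ.≤ y k) →
          Σ (ℕ → ℤ) λ y′ → Feasible G I v w y′ × cost G I v w y′ ≤G cost G I v w y ×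
                           distance x↑ y′ r q ℕ.< distance x↑ y r q × (Below↓ y → Below↓ y′)
        right-exchange y y-feasible {i} r<i i≤q yi<xi after
          with RightStep.right-step x↑ y x↑-feasible y-feasible i r<i i≤q yi<xi after
        ... | j , r<j , j≤q , pair =
          transfer y j i , y′-feasible ,
          exchange-improves (exchange-of-pair pair x↑-feasible y-feasible (ℕₚ.<⇒≤ p<r) ℕₚ.≤-refl r<j j≤q r<i i≤q)
                            (proj₂ x↑-optimal _ x′-feasible) ,
          transfer-closer x↑ y a≢b r<j j≤q r<i i≤q xa<ya yb<xb ,
          λ below k p<k k≤r → subst (ℤ._≤ x↓ k)
            (sym (transfer-other y (λ { refl → ℕₚ.<⇒≱ r<j k≤r }) (λ { refl → ℕₚ.<⇒≱ r<i k≤r })))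
            (below k p<k k≤r)
          where open ExchangePair pair

        -- Repeating left exchanges, by induction on a bound N for the distance to x↓.
        descend-left : ∀ N y → distance x↓ y p r ℕ.≤ N → Feasible G I v w y → Improvement Below↓ y
        descend-left N y dist≤N y-feasible =
          from-search (least-failure (λ k → y k ℤ.≤ x↓ k) (λ k → y k ℤₚ.≤? x↓ k) p r)
          where
          continue : ∀ N → distance x↓ y p r ℕ.≤ N →
            (Σ (ℕ → ℤ) λ y′ → Feasible G I v w y′ × cost G I v w y′ ≤G cost G I v w y ×
                              distance x↓ y′ p r ℕ.< distance x↓ y p r) → Improvement Below↓ y
          continue zero    dist≤0 (_ , _ , _ , closer) = ⊥-elim (ℕₚ.n≮0 (ℕₚ.<-≤-trans closer dist≤0))
          continue (suc N) dist≤ (y′ , y′-feasible , y′≤y , closer) =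
            let (y″ , y″-feasible , y″≤y′ , below″) =
                  descend-left N y′ (ℕₚ.≤-pred (ℕₚ.<-≤-trans closer dist≤)) y′-feasible
            in y″ , y″-feasible , ≤G-trans y″≤y′ y′≤y , below″
          from-search : LeastFailure (λ k → y k ℤ.≤ x↓ k) p r → Improvement Below↓ y
          from-search (inj₁ below) = y , y-feasible , ≤G-refl , below
          from-search (inj₂ (i , p<i , i≤r , y≰x , below)) =
            continue N dist≤N (left-exchange y y-feasible p<i i≤r (+1≤-from-≰ y≰x) below)

        descend-right : ∀ N y → distance x↑ y r q ℕ.≤ N → Feasible G I v w y → Below↓ y →
                        Improvement (λ y′ → Below↓ y′ × Above↑ y′) y
        descend-right N y dist≤N y-feasible below =
          from-search (greatest-failure (λ k → x↑ k ℤ.≤ y k) (λ k → x↑ k ℤₚ.≤? y k) r q)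
          where
          continue : ∀ N → distance x↑ y r q ℕ.≤ N →
            (Σ (ℕ → ℤ) λ y′ → Feasible G I v w y′ × cost G I v w y′ ≤G cost G I v w y ×
                              distance x↑ y′ r q ℕ.< distance x↑ y r q × (Below↓ y → Below↓ y′)) →
            Improvement (λ y′ → Below↓ y′ × Above↑ y′) y
          continue zero    dist≤0 (_ , _ , _ , closer , _) = ⊥-elim (ℕₚ.n≮0 (ℕₚ.<-≤-trans closer dist≤0))
          continue (suc N) dist≤ (y′ , y′-feasible , y′≤y , closer , keeps-below) =
            let (y″ , y″-feasible , y″≤y′ , sandwiched) =
                  descend-right N y′ (ℕₚ.≤-pred (ℕₚ.<-≤-trans closer dist≤)) y′-feasible (keeps-below below)
            in y″ , y″-feasible , ≤G-trans y″≤y′ y′≤y , sandwiched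
          from-search : GreatestFailure (λ k → x↑ k ℤ.≤ y k) r q → Improvement (λ y′ → Below↓ y′ × Above↑ y′) y
          from-search (inj₁ above) = y , y-feasible , ≤G-refl , below , above
          from-search (inj₂ (i , r<i , i≤q , x≰y , after)) =
            continue N dist≤N (right-exchange y y-feasible r<i i≤q (+1≤-from-≰ x≰y) after)

        sandwich : ∀ y → Feasible G I v w y → Improvement (λ y′ → Below↓ y′ × Above↑ y′) y
        sandwich y y-feasible =
          let (y₁ , y₁-feasible , y₁≤y , below) = descend-left (distance x↓ y p r) y ℕₚ.≤-refl y-feasible
              (y₂ , y₂-feasible , y₂≤y₁ , sandwiched) =
                descend-right (distance x↑ y₁ r q) y₁ ℕₚ.≤-refl y₁-feasible below
          in y₂ , y₂-feasible , ≤G-trans y₂≤y₁ y₁≤y , sandwiched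

      glue : (ℕ → ℤ) → (ℕ → ℤ) → ℕ → ℤ
      glue x↓ x↑ k with k ℕ.≤? r
      ... | yes _ = x↓ k
      ... | no _  = x↑ k

      -- The glued vector is feasible for NESTED(v,w): constraints up to t are
      -- those of x↓ (constraint t tight), and beyond t the bounds telescope.
      glue-feasible : ∀ x↓ x↑ → Feasible G I v t x↓ → Feasible G I (suc t) w x↑ → Feasible G I v w (glue x↓ x↑)
      glue-feasible x↓ x↑ (nested↓ , total↓ , box↓) (nested↑ , total↑ , box↑) = nested , total , box
        where
        z : ℕ → ℤ
        z = glue x↓ x↑
        left : ∀ {b} → b ℕ.≤ r → sumRange z p b ≡ sumRange x↓ p b
        left b≤r = sum-cong z x↓ p _ (λ k _ k≤b → by-cases k (ℕₚ.≤-trans k≤b b≤r))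
          where
          by-cases : ∀ k → k ℕ.≤ r → z k ≡ x↓ k
          by-cases k k≤r with k ℕ.≤? r
          ... | yes _   = refl
          ... | no k≰r  = ⊥-elim (k≰r k≤r)
        right : ∀ b → sumRange z r b ≡ sumRange x↑ r b
        right b = sum-cong z x↑ r b (λ k r<k _ → by-cases k r<k)
          where
          by-cases : ∀ k → r ℕ.< k → z k ≡ x↑ k
          by-cases k r<k with k ℕ.≤? r
          ... | yes k≤r = ⊥-elim (ℕₚ.<⇒≱ r<k k≤r)
          ... | no _    = refl
        beyond : ∀ {l} → t ℕ.≤ l → l ℕ.≤ m → sumRange z p (s l) ≡ sumRange x↑ r (s l) ℤ.+ (ā t ℤ.- ā (v ∸ 1))
        beyond t≤l l≤m = trans (sum-split z (ℕₚ.<⇒≤ p<r) (s-mono t≤l l≤m))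
                               (cong₂ ℤ._+_ (right _) (trans (left ℕₚ.≤-refl) total↓))
        nested : ∀ l → v ℕ.≤ l → l ℕ.< w → sumRange z p (s l) ℤ.≤ ā l ℤ.- ā (v ∸ 1)
        nested l v≤l l<w with l ℕ.<? t | t ℕ.≟ l
        ... | yes l<t | _ = subst (ℤ._≤ _) (sym (left (s-mono (ℕₚ.<⇒≤ l<t) t≤m))) (nested↓ l v≤l l<t)
        ... | no _ | yes refl = ℤₚ.≤-reflexive (trans (left ℕₚ.≤-refl) total↓)
        ... | no l≮t | no t≢l =
          subst₂ ℤ._≤_ (sym (beyond (ℕₚ.<⇒≤ t<l) (ℕₚ.≤-trans (ℕₚ.<⇒≤ l<w) w≤m))) (telescope (ā l) (ā t) (ā (v ∸ 1)))
                 (ℤₚ.+-monoˡ-≤ (ā t ℤ.- ā (v ∸ 1)) (nested↑ l t<l l<w))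
          where
          t<l : t ℕ.< l
          t<l = ℕₚ.≤∧≢⇒< (ℕₚ.≮⇒≥ l≮t) t≢l
        total : sumRange z p q ≡ ā w ℤ.- ā (v ∸ 1)
        total = trans (beyond (ℕₚ.<⇒≤ t<w) w≤m)
                      (trans (cong (ℤ._+ (ā t ℤ.- ā (v ∸ 1))) total↑) (telescope (ā w) (ā t) (ā (v ∸ 1))))
        box : ∀ k → p ℕ.< k → k ℕ.≤ q → (+ 0 ℤ.≤ z k) × (z k ℤ.≤ + d k)
        box k p<k k≤q with k ℕ.≤? r
        ... | yes k≤r = box↓ k p<k k≤r
        ... | no k≰r  = box↑ k (ℕₚ.≰⇒> k≰r) k≤q

theorem1 : (G : OrderedAbelianGroup) → (I : Instance G) →
    let open Instance I in
    1 ℕ.≤ n → 1 ℕ.≤ m → s 0 ≡ 0 → (∀ i → i ℕ.< m → s i ℕ.< s (suc i)) → s m ≡ n →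
    (∀ i → 1 ℕ.≤ i → i ℕ.≤ n → 1 ℕ.≤ d i) →
    (∀ i → 1 ℕ.≤ i → i ℕ.≤ n → DiscretelyConvexOn G (d i) (f i)) →
    (v t w : ℕ) → 1 ℕ.≤ v → v ℕ.≤ t → t ℕ.< w → w ℕ.≤ m →
    (x↓ x↑ : ℕ → ℤ) → Optimal G I v t x↓ → Optimal G I (suc t) w x↑ →
    Σ (ℕ → ℤ) λ x →
      Optimal G I v w x
      × (∀ i → s (v ∸ 1) ℕ.< i → i ℕ.≤ s t → x i ℤ.≤ x↓ i)
      × (∀ i → s t ℕ.< i → i ℕ.≤ s w → x↑ i ℤ.≤ x i)
theorem1 G I _ _ _ s-increasing s[m]≡n _ convex v t w 1≤v v≤t t<w w≤m x↓ x↑ x↓-optimal x↑-optimal =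
  let (y* , y*-feasible , y*-minimal) =
        optimum-exists (glue x↓ x↑) w≤m (glue-feasible x↓ x↑ (proj₁ x↓-optimal) (proj₁ x↑-optimal))
      (x** , x**-feasible , x**≤y* , below , above) = sandwich y* y*-feasible
  in x** , (x**-feasible , λ y y-feasible → ≤-trans x**≤y* (y*-minimal y y-feasible)) , below , above
  where
  open Nested G I
  open Breakpoints s-increasing
  open Blocks v t w 1≤v v≤t t<w w≤m
  open Descent s[m]≡n convex x↓ x↑ x↓-optimal x↑-optimal
  open GroupSums G using (≤-trans)
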